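{- Let $a,b$ be integers with $a-1>b\ge 1$, let $u_\beta=\lim_{n\to\infty}\varphi^n(0)$ be the fixed point of the substitution $\varphi(0)=0^a1$, $\varphi(1)=0^b1$, let $T(w)=0^b1\varphi(w)0^b$, and define $U^{(1)}=0^{a-1}$, $U^{(n)}=T(U^{(n-1)})$, $V^{(1)}=0^b$, $V^{(n)}=T(V^{(n-1)})$ for $n\ge 2$. Then for every integer $n\ge 0$: (i) If $b$ is even and $a$ odd: $\mathcal P(2n)=2$ if $|V^{(2k-1)}|<2n\le|U^{(2k-1)}|$ for some $k\in\mathbb N$, and $\mathcal P(2n)=1$ otherwise; $\mathcal P(2n+1)=3$ if $|V^{(2k)}|<2n+1\le |U^{(2k)}|$ for some $k\in\mathbb N$, and $\mathcal P(2n+1)=2$ otherwise. (ii) If $a$ and $b$ are both even: $\mathcal P(2n)=2$ if $|V^{(2k-1)}|<2n\le|U^{(2k)}|$ for some $k\in\mathbb N$, and $\mathcal P(2n)=1$ otherwise; $\mathcal P(2n+1)=2$ if $2n+1\le |U^{(1)}|=a-1$ or if $|V^{(2k)}|<2n+1\le|U^{(2k+1)}|$ for some $k\in\mathbb N$, and $\mathcal P(2n+1)=1$ otherwise. (iii) If $b$ is odd and $a$ even: $\mathcal P(2n)=2$ if $|V^{(3k-1)}|<2n\le|U^{(3k-1)}|$ for some $k\in\mathbb N$, and $\mathcal P(2n)=1$ otherwise; $\mathcal P(2n+1)=3$ if $|V^{(k)}|<2n+1\le |U^{(k)}|$ for some $k\in\mathbb N$ with $k\not\equiv 2 \pmod 3$,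 and $\mathcal P(2n+1)=2$ otherwise. (iv) If $a$ and $b$ are both odd: $\mathcal P(2n)=1$ if $0\le 2n\le |U^{(1)}|=a-1$, and $\mathcal P(2n)=0$ otherwise; $\mathcal P(2n+1)=2$ if $2n+1\le |V^{(1)}|=b$, $\mathcal P(2n+1)=4$ if $|V^{(k)}|<2n+1\le|U^{(k)}|$ for some $k\ge 2$, and $\mathcal P(2n+1)=3$ otherwise.
   Context: $\mathbb N$ denotes the positive integers, $|w|$ the length of a word $w$. $\mathcal P(m)$ is the number of distinct palindromes (words equal to their reversal) of length $m$ that are factors of $u_\beta$; the empty word is counted as the unique palindrome of length $0$. -}

module Defs where

open import Data.Nat using (ℕ; zero; suc; _+_; _∸_)
open import Data.Bool using (Bool; true; false)
open import Data.List using (List; []; _∷_; _++_; [_]; replicate; concatMap; map; upTo; length; reverse)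
open import Data.List.Relation.Unary.Unique.Propositional using (Unique)
open import Data.List.Membership.Propositional using (_∈_)
open import Data.Product using (Σ; ∃; ∃-syntax; _×_; _,_)
open import Relation.Binary.PropositionalEquality using (_≡_)

-- Letters: false = 0, true = 1.
Word : Set
Word = List Bool

φ : ℕ → ℕ → Word → Word
φ a b = concatMap letter
  where
  letter : Bool → Word
  letter false = replicate a false ++ [ true ]
  letter true  = replicate b false ++ [ true ]

φ^ : ℕ → ℕ → ℕ → Word → Word
φ^ a b zero    w = w
φ^ a b (suc n) w = φ a b (φ^ a b n w)

-- n-th letter of a finite word (default false when out of range; never
-- used out of range below)
nth : Word → ℕ → Bool
nth []      _       = false
nth (x ∷ _) zero    = x
nth (_ ∷ w) (suc i) = nth w i

-- Since every image φ(x) has length ≥ 2 and φ(0) begins with 0, the words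
-- φ^n(0) are successive prefixes and |φ^(i+1)(0)| > i, so the i-th letter
-- of u_β is the i-th letter of φ^(i+1)(0).
uβ : ℕ → ℕ → ℕ → Bool
uβ a b i = nth (φ^ a b (suc i) [ false ]) i

T : ℕ → ℕ → Word → Word
T a b w = replicate b false ++ (true ∷ (φ a b w ++ replicate b false))

-- U a b n = U^(n), V a b n = V^(n) for n ≥ 1 (index 0 is unused, set to []).
U : ℕ → ℕ → ℕ → Word
U a b zero          = []
U a b (suc zero)    = replicate (a ∸ 1) false
U a b (suc (suc n)) = T a b (U a b (suc n))

V : ℕ → ℕ → ℕ → Word
V a b zero          = []
V a b (suc zero)    = replicate b false
V a b (suc (suc n)) = T a b (V a b (suc n))

∣U∣ : ℕ → ℕ → ℕ → ℕ
∣U∣ a b n = length (U a b n)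

∣V∣ : ℕ → ℕ → ℕ → ℕ
∣V∣ a b n = length (V a b n)

Palindrome : Word → Set
Palindrome w = w ≡ reverse w

window : (ℕ → Bool) → ℕ → ℕ → Word
window u i m = map (λ j → u (i + j)) (upTo m)

Factor : (ℕ → Bool) → Word → Set
Factor u w = ∃[ i ] (window u i (length w) ≡ w)

-- PalCount a b m c  :⇔  𝒫(m) = c, i.e. the set of palindromic factors of u_β
-- of length m has exactly c elements: there is a duplicate-free list of
-- length c whose members are exactly those palindromic factors.
PalCount : ℕ → ℕ → ℕ → ℕ → Set
PalCount a b m c =
  ∃[ L ] (Unique L × length L ≡ c ×
    (∀ w → (w ∈ L → (length w ≡ m × Palindrome w × Factor (uβ a b) w))
         × ((length w ≡ m × Palindrome w × Factor (uβ a b) w) → w ∈ L)))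

-- Every factor of u_β is 0^k or 0^x 1 φ(q) 0^y, and since φ is a prefix code such a factor
-- can be desubstituted: 0^x 1 φ(q) 0^y is a factor iff s q t is one for letters s, t whose
-- images contain at least x resp. y zeros. Applied to the extensions 0w0 and 1w1 of a
-- palindromic factor w this shows that both are factors iff w is some V^(n), neither iff w
-- is some U^(n), and exactly one otherwise. Every palindrome of length m + 2 is 0w0 or 1w1
-- for a palindrome w of length m, so
--   𝒫(m + 2) = 𝒫(m) + [m = |V^(n)| for some n] − [m = |U^(n)| for some n].
-- The lengths interleave, |V^(1)| < |U^(1)| < |V^(2)| < |U^(2)| < …, and their parities are
-- eventually periodic in n, since T acts linearly (mod 2) on the numbers of zeros and ones.
-- Within each parity class of m the count therefore rises by one at each |V^(n)| and drops
-- back at the next |U^(n)|; the parity pattern, which depends on the parities of a and b,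
-- gives the four cases.

module Submission where

open import Defs
open import Data.Nat using (ℕ; zero; suc; _+_; _*_; _∸_; _%_; _≤_; _<_; z≤n; s≤s; _≟_; _≤?_; ⌊_/2⌋; >-nonZero)
open import Data.Nat.Properties
open import Data.Nat.Divisibility using (_∣_; divides)
open import Data.Nat.DivMod using ([m+n]%n≡m%n; [m+kn]%n≡m%n)
open import Data.Nat.GeneralisedArithmetic using (fold)
open import Algebra.Properties.CommutativeSemigroup +-commutativeSemigroup using (interchange; x∙yz≈y∙xz)
open import Data.Bool using (Bool; true; false; not; _xor_; _∧_)
open import Data.Bool.Properties
  using (∧-zeroʳ; not-distribˡ-xor; not-distribʳ-xor; not-involutive; xor-identityʳ; xor-comm; xor-assoc; xor-same; not-¬)
open import Data.Fin using (toℕ; fromℕ<)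
open import Data.Fin.Properties using (any?; toℕ-fromℕ<)
open import Data.List using (List; []; _∷_; _++_; [_]; _∷ʳ_; replicate; reverse; length; take; drop; applyUpTo; initLast; _∷ʳ′_)
open import Data.List.Properties
  using ( ++-assoc; ++-identityʳ; ++-conicalˡ; ++-cancelʳ; ∷-injective; ∷ʳ-injective; ∷ʳ-injectiveˡ; reverse-++; unfold-reverse
        ; reverse-involutive; length-++; length-replicate; map-upTo; take++drop≡id; ++-monoid)
open import Algebra.Solver.Monoid (++-monoid Bool) using (solve; _⊜_; _⊕_; id)
open import Data.List.Relation.Unary.All as All using (All; []; _∷_)
open import Data.List.Relation.Unary.Any using (here; there)
open import Data.List.Relation.Unary.Unique.Propositional using (Unique; []; _∷_)
open import Data.List.Relation.Unary.Unique.Propositional.Properties using (++⁺)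
open import Data.List.Membership.Propositional using (_∈_)
open import Data.List.Membership.Propositional.Properties using (∈-++⁺ˡ; ∈-++⁺ʳ; ∈-++⁻)
open import Data.Product using (∃; ∃₂; ∃-syntax; _×_; _,_; proj₁; proj₂)
open import Data.Sum using (_⊎_; inj₁; inj₂)
open import Data.Empty using (⊥; ⊥-elim)
open import Function using (_∘_; _∘′_; _⇔_; mk⇔; Equivalence)
open import Relation.Nullary using (¬_; Dec; yes; no; contradiction)
open import Relation.Nullary.Decidable using (map′)
open import Relation.Binary using (Tri; tri<; tri≈; tri>)
open import Relation.Binary.PropositionalEquality
  using (_≡_; _≢_; refl; sym; trans; cong; cong₂; subst; subst₂; module ≡-Reasoning)
open Equivalence using (to; from)

zeros : ℕ → Word
zeros k = replicate k false

zeros-suc : ∀ j r → zeros j ++ false ∷ r ≡ zeros (suc j) ++ r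
zeros-suc zero    r = refl
zeros-suc (suc j) r = cong (false ∷_) (zeros-suc j r)

zeros-+ : ∀ j k → zeros (j + k) ≡ zeros j ++ zeros k
zeros-+ zero    k = refl
zeros-+ (suc j) k = cong (false ∷_) (zeros-+ j k)

zeros-injective : ∀ {j k} → zeros j ≡ zeros k → j ≡ k
zeros-injective {j} {k} e = trans (sym (length-replicate j)) (trans (cong length e) (length-replicate k))

zeros-∷ʳ : ∀ k → zeros k ∷ʳ false ≡ zeros (suc k)
zeros-∷ʳ k = trans (zeros-suc k []) (++-identityʳ _)

reverse-zeros : ∀ k → reverse (zeros k) ≡ zeros k
reverse-zeros zero    = refl
reverse-zeros (suc k) = begin
  reverse (false ∷ zeros k)  ≡⟨ unfold-reverse false (zeros k) ⟩
  reverse (zeros k) ∷ʳ false ≡⟨ cong (_∷ʳ false) (reverse-zeros k) ⟩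
  zeros k ∷ʳ false           ≡⟨ zeros-∷ʳ k ⟩
  zeros (suc k)              ∎
  where open ≡-Reasoning

zeros≢zeros-1 : ∀ k j X → zeros k ≢ zeros j ++ true ∷ X
zeros≢zeros-1 zero    zero    X ()
zeros≢zeros-1 zero    (suc j) X ()
zeros≢zeros-1 (suc k) zero    X ()
zeros≢zeros-1 (suc k) (suc j) X e = zeros≢zeros-1 k j X (cong (drop 1) e)

zeros-1-injective : ∀ j k X Y → zeros j ++ true ∷ X ≡ zeros k ++ true ∷ Y → j ≡ k × X ≡ Y
zeros-1-injective zero    zero    X Y refl = refl , refl
zeros-1-injective (suc j) (suc k) X Y e with zeros-1-injective j k X Y (cong (drop 1) e)
... | refl , X≡Y = refl , X≡Y

zeros-before-1 : ∀ y k A B → zeros y ++ A ≡ zeros k ++ true ∷ B → y ≤ k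
zeros-before-1 zero    k       A B e = z≤n
zeros-before-1 (suc y) (suc k) A B e = s≤s (zeros-before-1 y k A B (cong (drop 1) e))

split-at-1 : ∀ j X P R → zeros j ++ true ∷ X ≡ P ++ true ∷ R →
             (P ≡ zeros j × X ≡ R) ⊎ (∃ λ P′ → P ≡ zeros j ++ true ∷ P′ × X ≡ P′ ++ true ∷ R)
split-at-1 zero    X []          R refl = inj₁ (refl , refl)
split-at-1 zero    X (true ∷ P)  R refl = inj₂ (P , refl , refl)
split-at-1 (suc j) X (false ∷ P) R e with split-at-1 j X P R (cong (drop 1) e)
... | inj₁ (refl , X≡R)       = inj₁ (refl , X≡R)
... | inj₂ (P′ , refl , X≡P′) = inj₂ (P′ , refl , X≡P′)

split-at-zeros : ∀ j k X P S → zeros j ++ true ∷ X ≡ P ++ zeros k ++ S →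
                 k ≤ j ⊎ (∃ λ P′ → P ≡ zeros j ++ true ∷ P′ × X ≡ P′ ++ zeros k ++ S)
split-at-zeros j       k X []          S e = inj₁ (prefix j k e)
  where
  prefix : ∀ j k → zeros j ++ true ∷ X ≡ zeros k ++ S → k ≤ j
  prefix j       zero    e = z≤n
  prefix (suc j) (suc k) e = s≤s (prefix j k (cong (drop 1) e))
split-at-zeros zero    k X (true ∷ P)  S refl = inj₂ (P , refl , refl)
split-at-zeros (suc j) k X (false ∷ P) S e with split-at-zeros j k X P S (cong (drop 1) e)
... | inj₁ k≤j                = inj₁ (m≤n⇒m≤1+n k≤j)
... | inj₂ (P′ , refl , X≡P′) = inj₂ (P′ , refl , X≡P′)

longer-zeros-prefix : ∀ x k A B → zeros x ++ A ≡ zeros k ++ B → k < x → ∃ λ B′ → B ≡ false ∷ B′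
longer-zeros-prefix (suc x) zero    A B e _         = zeros x ++ A , sym e
longer-zeros-prefix (suc x) (suc k) A B e (s≤s k<x) = longer-zeros-prefix x k A B (cong (drop 1) e) k<x

longer-zeros-suffix : ∀ x k P Q → P ++ zeros x ≡ Q ++ zeros k → k < x → ∃ λ Q′ → Q ≡ Q′ ∷ʳ false
longer-zeros-suffix x k P Q e k<x =
  let (Q′ , Q≡) = longer-zeros-prefix x k (reverse P) (reverse Q) reversed k<x
  in reverse Q′ , (begin
    Q                       ≡⟨ sym (reverse-involutive Q) ⟩
    reverse (reverse Q)     ≡⟨ cong reverse Q≡ ⟩
    reverse (false ∷ Q′)    ≡⟨ unfold-reverse false Q′ ⟩
    reverse Q′ ∷ʳ false     ∎)
  where
  open ≡-Reasoning
  reversed : zeros x ++ reverse P ≡ zeros k ++ reverse Q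
  reversed = begin
    zeros x ++ reverse P           ≡⟨ cong (_++ reverse P) (sym (reverse-zeros x)) ⟩
    reverse (zeros x) ++ reverse P ≡⟨ sym (reverse-++ P (zeros x)) ⟩
    reverse (P ++ zeros x)         ≡⟨ cong reverse e ⟩
    reverse (Q ++ zeros k)         ≡⟨ reverse-++ Q (zeros k) ⟩
    reverse (zeros k) ++ reverse Q ≡⟨ cong (_++ reverse Q) (reverse-zeros k) ⟩
    zeros k ++ reverse Q           ∎

zeros-or-first-1 : ∀ w → (∃ λ k → w ≡ zeros k) ⊎ (∃₂ λ x r → w ≡ zeros x ++ true ∷ r)
zeros-or-first-1 []          = inj₁ (0 , refl)
zeros-or-first-1 (true ∷ w)  = inj₂ (0 , w , refl)
zeros-or-first-1 (false ∷ w) with zeros-or-first-1 w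
... | inj₁ (k , refl)     = inj₁ (suc k , refl)
... | inj₂ (x , r , refl) = inj₂ (suc x , r , refl)

infix 4 _⊑_
_⊑_ : Word → Word → Set
w ⊑ v = ∃₂ λ p s → v ≡ p ++ w ++ s

⊑-trans : ∀ {u v w} → u ⊑ v → v ⊑ w → u ⊑ w
⊑-trans {u} (p , s , refl) (p′ , s′ , refl) =
  p′ ++ p , s ++ s′ ,
  solve 5 (λ p′ p u s s′ → p′ ⊕ (p ⊕ u ⊕ s) ⊕ s′ ⊜ (p′ ⊕ p) ⊕ u ⊕ s ⊕ s′) refl p′ p u s s′

⊑-wrap : ∀ {w} s t → w ⊑ s ∷ w ++ [ t ]
⊑-wrap s t = [ s ] , [ t ] , refl

++-∷≢[] : ∀ A {x : Bool} {Y} → A ++ x ∷ Y ≢ []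
++-∷≢[] []      ()
++-∷≢[] (_ ∷ _) ()

∷-as-∷ʳ : ∀ (x : Bool) xs → ∃₂ λ ys y → x ∷ xs ≡ ys ∷ʳ y
∷-as-∷ʳ x []       = [] , x , refl
∷-as-∷ʳ x (z ∷ xs) with ∷-as-∷ʳ z xs
... | ys , y , e = x ∷ ys , y , cong (x ∷_) e

wrap : Bool → Word → Word
wrap s w = s ∷ w ++ [ s ]

wrap-injective : ∀ {s t w w′} → wrap s w ≡ wrap t w′ → s ≡ t × w ≡ w′
wrap-injective {w = w} {w′} e with ∷-injective e
... | refl , e′ = refl , ∷ʳ-injectiveˡ w w′ e′

reverse-++³ : ∀ (A B C : Word) → reverse (A ++ B ++ C) ≡ reverse C ++ reverse B ++ reverse A
reverse-++³ A B C = trans (reverse-++ A (B ++ C))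
                          (trans (cong (_++ reverse A) (reverse-++ B C)) (++-assoc (reverse C) (reverse B) (reverse A)))

reverse-∷-∷ʳ : ∀ (s : Bool) w t → reverse (s ∷ (w ∷ʳ t)) ≡ t ∷ (reverse w ∷ʳ s)
reverse-∷-∷ʳ s w t = trans (unfold-reverse s (w ∷ʳ t)) (cong (_∷ʳ s) (reverse-++ w [ t ]))

reverse-wrap : ∀ s w → reverse (wrap s w) ≡ wrap s (reverse w)
reverse-wrap s w = reverse-∷-∷ʳ s w s

length-wrap : ∀ s w → length (wrap s w) ≡ 2 + length w
length-wrap s w = cong suc (trans (length-++ w) (+-comm (length w) 1))

wrap-palindrome : ∀ s {w} → Palindrome w → Palindrome (wrap s w)
wrap-palindrome s {w} w≡ = trans (cong (wrap s) w≡) (sym (reverse-wrap s w))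

palindrome-unwrap : ∀ m v → Palindrome v → length v ≡ 2 + m →
                    ∃₂ λ s w → v ≡ wrap s w × Palindrome w × length w ≡ m
palindrome-unwrap m (s ∷ x ∷ v′) v≡ |v| with ∷-as-∷ʳ x v′
... | w , t , e with ∷-injective (trans (cong (s ∷_) (sym e))
                                  (trans v≡ (trans (cong (λ z → reverse (s ∷ z)) e) (reverse-∷-∷ʳ s w t))))
...   | refl , e′ with ∷ʳ-injectiveˡ w (reverse w) e′
...     | w≡ = s , w , cong (s ∷_) e , w≡ ,
              suc-injective (suc-injective (trans (sym (length-wrap s w))
                                              (trans (cong (λ z → length (s ∷ z)) (sym e)) |v|)))

∣_∣₀ ∣_∣₁ : Word → ℕ
∣ []        ∣₀ = 0
∣ false ∷ w ∣₀ = suc ∣ w ∣₀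
∣ true  ∷ w ∣₀ = ∣ w ∣₀
∣ []        ∣₁ = 0
∣ false ∷ w ∣₁ = ∣ w ∣₁
∣ true  ∷ w ∣₁ = suc ∣ w ∣₁

∣++∣₀ : ∀ x y → ∣ x ++ y ∣₀ ≡ ∣ x ∣₀ + ∣ y ∣₀
∣++∣₀ []          y = refl
∣++∣₀ (false ∷ x) y = cong suc (∣++∣₀ x y)
∣++∣₀ (true  ∷ x) y = ∣++∣₀ x y

∣++∣₁ : ∀ x y → ∣ x ++ y ∣₁ ≡ ∣ x ∣₁ + ∣ y ∣₁
∣++∣₁ []          y = refl
∣++∣₁ (false ∷ x) y = ∣++∣₁ x y
∣++∣₁ (true  ∷ x) y = cong suc (∣++∣₁ x y)

length≡∣∣₀+∣∣₁ : ∀ w → length w ≡ ∣ w ∣₀ + ∣ w ∣₁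
length≡∣∣₀+∣∣₁ []          = refl
length≡∣∣₀+∣∣₁ (false ∷ w) = cong suc (length≡∣∣₀+∣∣₁ w)
length≡∣∣₀+∣∣₁ (true  ∷ w) = trans (cong suc (length≡∣∣₀+∣∣₁ w)) (sym (+-suc ∣ w ∣₀ ∣ w ∣₁))

∣zeros∣₀ : ∀ k → ∣ zeros k ∣₀ ≡ k
∣zeros∣₀ zero    = refl
∣zeros∣₀ (suc k) = cong suc (∣zeros∣₀ k)

∣zeros∣₁ : ∀ k → ∣ zeros k ∣₁ ≡ 0
∣zeros∣₁ zero    = refl
∣zeros∣₁ (suc k) = ∣zeros∣₁ k

nth-++ˡ : ∀ A B k → k < length A → nth (A ++ B) k ≡ nth A k
nth-++ˡ (x ∷ A) B zero    _         = refl
nth-++ˡ (x ∷ A) B (suc k) (s≤s k<A) = nth-++ˡ A B k k<A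

applyUpTo-nth : ∀ v i m (f : ℕ → Bool) → i + m ≤ length v → (∀ j → j < m → f j ≡ nth v (i + j)) →
                applyUpTo f m ≡ take m (drop i v)
applyUpTo-nth v       zero    zero    f _         _  = refl
applyUpTo-nth (x ∷ v) zero    (suc m) f (s≤s i+m≤) fj =
  cong₂ _∷_ (fj 0 (s≤s z≤n)) (applyUpTo-nth v 0 m (λ j → f (suc j)) i+m≤ (λ j j<m → fj (suc j) (s≤s j<m)))
applyUpTo-nth (x ∷ v) (suc i) m       f (s≤s i+m≤) fj = applyUpTo-nth v i m f i+m≤ fj

take-drop-++ : ∀ (p w s : Word) → take (length w) (drop (length p) (p ++ w ++ s)) ≡ w
take-drop-++ (_ ∷ p) w       s = take-drop-++ p w s
take-drop-++ []      []      s = refl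
take-drop-++ []      (x ∷ w) s = cong (x ∷_) (take-drop-++ [] w s)

occurrence-bound : ∀ (p w s : Word) {v} → v ≡ p ++ w ++ s → length p + length w ≤ length v
occurrence-bound p w s refl = begin
  length p + length w              ≤⟨ +-monoʳ-≤ (length p) (m≤m+n (length w) (length s)) ⟩
  length p + (length w + length s) ≡⟨ cong (length p +_) (sym (length-++ w)) ⟩
  length p + length (w ++ s)       ≡⟨ sym (length-++ p) ⟩
  length (p ++ w ++ s)             ∎
  where open ≤-Reasoning

∃-≥ : ∀ d {P : ℕ → Set} → (∃[ k ] (d ≤ k × P k)) ⇔ (∃[ k ] P (d + k))
∃-≥ d {P} = mk⇔ (λ (k , d≤k , Pk) → k ∸ d , subst P (sym (m+[n∸m]≡n d≤k)) Pk)
                (λ (k , Pk) → d + k , m≤m+n d k , Pk)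

via : ∀ {A B X Y : Set} → A ⇔ B → (B → X) × (¬ B → Y) → (A → X) × (¬ A → Y)
via A⇔B (B→X , ¬B→Y) = B→X ∘ to A⇔B , λ ¬A → ¬B→Y (¬A ∘ from A⇔B)

⊎-⇔ : ∀ {A B C : Set} → ¬ A → B ⇔ C → (A ⊎ B) ⇔ C
⊎-⇔ ¬A B⇔C = mk⇔ (λ { (inj₁ a) → contradiction a ¬A ; (inj₂ b) → to B⇔C b }) (inj₂ ∘ from B⇔C)

parity : ℕ → Bool
parity zero    = false
parity (suc n) = not (parity n)

parity-+ : ∀ m n → parity (m + n) ≡ parity m xor parity n
parity-+ zero    n = refl
parity-+ (suc m) n = trans (cong not (parity-+ m n)) (not-distribˡ-xor (parity m) (parity n))

parity-* : ∀ m n → parity (m * n) ≡ parity m ∧ parity n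
parity-* zero    n = refl
parity-* (suc m) n rewrite parity-+ n (m * n) | parity-* m n with parity m | parity n
... | true  | true  = refl
... | true  | false = refl
... | false | true  = refl
... | false | false = refl

parity-2* : ∀ k → parity (2 * k) ≡ false
parity-2* k = parity-* 2 k

parity-2*+ : ∀ j r → parity (2 * j + r) ≡ parity r
parity-2*+ j r = trans (parity-+ (2 * j) r) (cong (_xor parity r) (parity-2* j))

parity-2*+1 : ∀ k → parity (2 * k + 1) ≡ true
parity-2*+1 k = parity-2*+ k 1

same-parity-gap : ∀ {x y} → parity x ≡ parity y → x < y → 2 + x ≤ y
same-parity-gap {x} px≡py x<y with m≤n⇒m<n∨m≡n x<y
... | inj₁ 1+x<y = 1+x<y
... | inj₂ refl  = contradiction px≡py (not-¬ refl)

even⇒2*half : ∀ n → parity n ≡ false → 2 * ⌊ n /2⌋ ≡ n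
even⇒2*half zero          _ = refl
even⇒2*half (suc (suc n)) e =
  trans (*-suc 2 ⌊ n /2⌋) (cong (2 +_) (even⇒2*half n (trans (sym (not-involutive (parity n))) e)))

odd⇒2*half+1 : ∀ n → parity n ≡ true → 2 * ⌊ n /2⌋ + 1 ≡ n
odd⇒2*half+1 (suc zero)    _ = refl
odd⇒2*half+1 (suc (suc n)) e =
  trans (cong (_+ 1) (*-suc 2 ⌊ n /2⌋)) (cong (2 +_) (odd⇒2*half+1 n (trans (sym (not-involutive (parity n))) e)))

2*half+parity : ∀ {r} n → r ≤ 1 → parity n ≡ parity r → 2 * ⌊ n /2⌋ + r ≡ n
2*half+parity {zero}        n _ e = trans (+-identityʳ _) (even⇒2*half n e)
2*half+parity {suc zero}    n _ e = odd⇒2*half+1 n e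
2*half+parity {suc (suc _)} n (s≤s ()) _

2∣⇒even : ∀ {n} → 2 ∣ n → parity n ≡ false
2∣⇒even (divides q refl) = trans (parity-* q 2) (∧-zeroʳ (parity q))

2∤⇒odd : ∀ {n} → ¬ 2 ∣ n → parity n ≡ true
2∤⇒odd {n} 2∤n with parity n in e
... | true  = refl
... | false = contradiction (divides ⌊ n /2⌋ (sym (trans (*-comm ⌊ n /2⌋ 2) (even⇒2*half n e)))) 2∤n

2*suc∸1 : ∀ k → 2 * suc k ∸ 1 ≡ suc (2 * k)
2*suc∸1 k = +-suc k (k + 0)

2*suc+1≡2*suc∸1 : ∀ k → 2 * suc k + 1 ≡ 2 * suc (suc k) ∸ 1
2*suc+1≡2*suc∸1 k = trans (+-comm (2 * suc k) 1) (sym (2*suc∸1 (suc k)))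

1≤2*suc∸1 : ∀ k → 1 ≤ 2 * suc k ∸ 1
1≤2*suc∸1 k = subst (1 ≤_) (sym (2*suc∸1 k)) (s≤s z≤n)

2*suc∸1≤2*suc : ∀ k → 2 * suc k ∸ 1 ≤ 2 * suc k
2*suc∸1≤2*suc k = m∸n≤m (2 * suc k) 1

2*suc<2*suc∸1 : ∀ k → 2 * suc k < 2 * suc (suc k) ∸ 1
2*suc<2*suc∸1 k = subst (2 * suc k <_) (sym (2*suc∸1 (suc k))) (s≤s ≤-refl)

even⇒suc≡2*suc∸1 : ∀ n → parity n ≡ false → suc n ≡ 2 * suc ⌊ n /2⌋ ∸ 1
even⇒suc≡2*suc∸1 n e = trans (cong suc (sym (even⇒2*half n e))) (sym (2*suc∸1 ⌊ n /2⌋))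

odd⇒suc≡2*suc : ∀ n → parity n ≡ true → suc n ≡ 2 * suc ⌊ n /2⌋
odd⇒suc≡2*suc n e = trans (cong suc (sym (odd⇒2*half+1 n e))) (trans (cong suc (+-comm _ 1)) (sym (*-suc 2 ⌊ n /2⌋)))

xor-true : ∀ p → p xor true ≡ not p
xor-true false = refl
xor-true true  = refl

xor-cancelˡ : ∀ p {x y} → p xor x ≡ p xor y → x ≡ y
xor-cancelˡ false e = e
xor-cancelˡ true {x} {y} e = trans (sym (not-involutive x)) (trans (cong not e) (not-involutive y))

module AlternatingParity (f : ℕ → ℕ) (p : Bool) (parity-f : ∀ n → parity (f (suc n)) ≡ p xor parity n) where

  odd-indices : ∀ k → parity (f (2 * suc k ∸ 1)) ≡ p
  odd-indices k = begin
    parity (f (2 * suc k ∸ 1)) ≡⟨ cong (parity ∘ f) (2*suc∸1 k) ⟩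
    parity (f (suc (2 * k)))   ≡⟨ parity-f (2 * k) ⟩
    p xor parity (2 * k)       ≡⟨ cong (p xor_) (parity-2* k) ⟩
    p xor false                ≡⟨ xor-identityʳ p ⟩
    p                          ∎
    where open ≡-Reasoning

  even-indices : ∀ k → parity (f (2 * suc k)) ≡ not p
  even-indices k = begin
    parity (f (2 * suc k))     ≡⟨ cong (parity ∘ f) (trans (*-suc 2 k) (cong suc (+-comm 1 (2 * k)))) ⟩
    parity (f (suc (2 * k + 1))) ≡⟨ parity-f (2 * k + 1) ⟩
    p xor parity (2 * k + 1)   ≡⟨ cong (p xor_) (parity-2*+1 k) ⟩
    p xor true                 ≡⟨ xor-true p ⟩
    not p                      ∎
    where open ≡-Reasoning

  only-odd-indices : ∀ n → parity (f (suc n)) ≡ p → suc n ≡ 2 * suc ⌊ n /2⌋ ∸ 1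
  only-odd-indices n e = even⇒suc≡2*suc∸1 n (xor-cancelˡ p (trans (sym (parity-f n)) (trans e (sym (xor-identityʳ p)))))

  only-even-indices : ∀ n → parity (f (suc n)) ≡ not p → suc n ≡ 2 * suc ⌊ n /2⌋
  only-even-indices n e = odd⇒suc≡2*suc n (xor-cancelˡ p (trans (sym (parity-f n)) (trans e (sym (xor-true p)))))

-- Parities of the numbers of zeros and of ones of a word w ↦ T(w), where
-- |T(w)|₀ = a|w|₀ + b|w|₁ + 2b and |T(w)|₁ = |w|₀ + |w|₁ + 1.
T-step : Bool → Bool → Bool × Bool → Bool × Bool
T-step pa pb (z , o) = (pa ∧ z) xor (pb ∧ o) , not (z xor o)

total : Bool × Bool → Bool
total (z , o) = z xor o

fold-T-step-true-false : ∀ n → fold (false , false) (T-step true false) n ≡ (false , parity n)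
fold-T-step-true-false zero    = refl
fold-T-step-true-false (suc n) rewrite fold-T-step-true-false n = refl

total-T-step-false-false : ∀ s → total (T-step false false s) ≡ not (total s)
total-T-step-false-false (z , o) = refl

total-fold-false-false : ∀ s n → total (fold s (T-step false false) n) ≡ total s xor parity n
total-fold-false-false s zero    = sym (xor-identityʳ (total s))
total-fold-false-false s (suc n) =
  trans (total-T-step-false-false (fold s (T-step false false) n))
        (trans (cong not (total-fold-false-false s n)) (not-distribʳ-xor (total s) (parity n)))

T-step-false-true³ : ∀ s → T-step false true (T-step false true (T-step false true s)) ≡ s
T-step-false-true³ (false , false) = refl
T-step-false-true³ (false , true)  = refl
T-step-false-true³ (true  , false) = refl
T-step-false-true³ (true  , true)  = refl

total-T-step-true-true : ∀ s → total (T-step true true s) ≡ true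
total-T-step-true-true (false , false) = refl
total-T-step-true-true (false , true)  = refl
total-T-step-true-true (true  , false) = refl
total-T-step-true-true (true  , true)  = refl

3+n%3 : ∀ n → (3 + n) % 3 ≡ n % 3
3+n%3 n = trans (cong (_% 3) (+-comm 3 n)) ([m+n]%n≡m%n n 3)

ParityByResidue : Bool → ℕ → Set
ParityByResidue p r = (p ≡ false × r ≡ 2) ⊎ (p ≡ true × r ≢ 2)

-- The parity of |V^(n+1)| when a is even and b is odd; it has period 3.
total-fold-false-true : ∀ n → ParityByResidue (total (fold (true , false) (T-step false true) n)) (suc n % 3)
total-fold-false-true 0 = inj₂ (refl , λ ())
total-fold-false-true 1 = inj₁ (refl , refl)
total-fold-false-true 2 = inj₂ (refl , λ ())
total-fold-false-true (suc (suc (suc n))) =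
  subst₂ ParityByResidue (sym (cong total (T-step-false-true³ (fold (true , false) (T-step false true) n))))
                      (sym (3+n%3 (suc n))) (total-fold-false-true n)

3*suc∸1≡2+3* : ∀ i → 3 * suc i ∸ 1 ≡ 2 + 3 * i
3*suc∸1≡2+3* i = cong (_∸ 1) (*-suc 3 i)

[3*suc∸1]%3 : ∀ i → (3 * suc i ∸ 1) % 3 ≡ 2
[3*suc∸1]%3 i = begin
  (3 * suc i ∸ 1) % 3   ≡⟨ cong (_% 3) (3*suc∸1≡2+3* i) ⟩
  (2 + 3 * i) % 3       ≡⟨ cong (λ m → (2 + m) % 3) (*-comm 3 i) ⟩
  (2 + i * 3) % 3       ≡⟨ [m+kn]%n≡m%n 2 i 3 ⟩
  2                     ∎
  where open ≡-Reasoning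

3+[3*suc∸1] : ∀ i → 3 + (3 * suc i ∸ 1) ≡ 3 * suc (suc i) ∸ 1
3+[3*suc∸1] i = begin
  3 + (3 * suc i ∸ 1)   ≡⟨ cong (3 +_) (3*suc∸1≡2+3* i) ⟩
  2 + (3 + 3 * i)       ≡⟨ cong (2 +_) (sym (*-suc 3 i)) ⟩
  2 + 3 * suc i         ≡⟨ sym (3*suc∸1≡2+3* (suc i)) ⟩
  3 * suc (suc i) ∸ 1   ∎
  where open ≡-Reasoning

%3≡2⇒ : ∀ k → k % 3 ≡ 2 → ∃ λ i → k ≡ 3 * suc i ∸ 1
%3≡2⇒ 2 _ = 0 , refl
%3≡2⇒ (suc (suc (suc k))) e with %3≡2⇒ k (trans (sym (3+n%3 k)) e)
... | i , refl = suc i , 3+[3*suc∸1] i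

not-2-mod-3 : ℕ → ℕ
not-2-mod-3 0             = 1
not-2-mod-3 1             = 3
not-2-mod-3 (suc (suc i)) = 3 + not-2-mod-3 i

not-2-mod-3-spec : ∀ i → 1 ≤ not-2-mod-3 i × not-2-mod-3 i % 3 ≢ 2
not-2-mod-3-spec 0             = s≤s z≤n , λ ()
not-2-mod-3-spec 1             = s≤s z≤n , λ ()
not-2-mod-3-spec (suc (suc i)) with not-2-mod-3-spec i
... | _ , ≢2 = s≤s z≤n , λ e → ≢2 (trans (sym (3+n%3 (not-2-mod-3 i))) e)

not-2-mod-3-onto : ∀ k → 1 ≤ k → k % 3 ≢ 2 → ∃ λ i → k ≡ not-2-mod-3 i
not-2-mod-3-onto 1 _ _ = 0 , refl
not-2-mod-3-onto 2 _ ≢2 = contradiction refl ≢2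
not-2-mod-3-onto 3 _ _ = 1 , refl
not-2-mod-3-onto (suc (suc (suc (suc k)))) _ ≢2 with not-2-mod-3-onto (suc k) (s≤s z≤n) (λ e → ≢2 (trans (3+n%3 (suc k)) e))
... | i , 1+k≡ = suc (suc i) , cong (3 +_) 1+k≡

not-2-mod-3-< : ∀ i → not-2-mod-3 i < not-2-mod-3 (suc i)
not-2-mod-3-< 0             = s≤s (s≤s z≤n)
not-2-mod-3-< 1             = s≤s ≤-refl
not-2-mod-3-< (suc (suc i)) = +-monoʳ-< 3 (not-2-mod-3-< i)

module StrictlyIncreasing (f : ℕ → ℕ) (f< : ∀ n → f n < f (suc n)) where

  mono-< : ∀ {m n} → m < n → f m < f n
  mono-< {m} {suc n} (s≤s m≤n) with m≤n⇒m<n∨m≡n m≤n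
  ... | inj₁ m<n  = <-trans (mono-< m<n) (f< n)
  ... | inj₂ refl = f< n

  mono-≤ : ∀ {m n} → m ≤ n → f m ≤ f n
  mono-≤ m≤n with m≤n⇒m<n∨m≡n m≤n
  ... | inj₁ m<n  = <⇒≤ (mono-< m<n)
  ... | inj₂ refl = ≤-refl

  injective : ∀ {m n} → f m ≡ f n → m ≡ n
  injective {m} {n} e with <-cmp m n
  ... | tri< m<n _ _ = contradiction e (<⇒≢ (mono-< m<n))
  ... | tri≈ _ m≡n _ = m≡n
  ... | tri> _ _ n<m = contradiction (sym e) (<⇒≢ (mono-< n<m))

  n≤f : ∀ n → n ≤ f n
  n≤f zero    = z≤n
  n≤f (suc n) = <-≤-trans (s≤s (n≤f n)) (f< n)

  image? : ∀ j → Dec (∃ λ k → f k ≡ j)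
  image? j = map′ (λ (i , e) → toℕ i , e)
                  (λ (k , e) → fromℕ< (s≤s (subst (k ≤_) e (n≤f k))) , trans (cong f (toℕ-fromℕ< _)) e)
                  (any? λ i → f (toℕ i) ≟ j)

module _ {A : Set} {P : A → Set} (t : ∀ {x} → P x → ℕ) where

  ∑ : ∀ {xs} → All P xs → ℕ
  ∑ []       = 0
  ∑ (p ∷ ps) = t p + ∑ ps

  ∑-zero : ∀ {xs} (ps : All P xs) → (∀ {x} (p : P x) → x ∈ xs → t p ≡ 0) → ∑ ps ≡ 0
  ∑-zero []       _  = refl
  ∑-zero (p ∷ ps) t0 = cong₂ _+_ (t0 p (here refl)) (∑-zero ps (λ p′ x∈ → t0 p′ (there x∈)))

  ∑-single : ∀ {xs x₀} (ps : All P xs) → Unique xs → x₀ ∈ xs →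
             (∀ (p : P x₀) → t p ≡ 1) → (∀ {x} (p : P x) → x ∈ xs → x ≢ x₀ → t p ≡ 0) → ∑ ps ≡ 1
  ∑-single (p ∷ ps) (x∉ ∷ u) (here refl) t1 t0 =
    cong₂ _+_ (t1 p) (∑-zero ps (λ p′ x′∈ → t0 p′ (there x′∈) (All.lookup x∉ x′∈ ∘ sym)))
  ∑-single (p ∷ ps) (x∉ ∷ u) (there x₀∈) t1 t0 =
    cong₂ _+_ (t0 p (here refl) (All.lookup x∉ x₀∈)) (∑-single ps u x₀∈ t1 (λ p′ x′∈ → t0 p′ (there x′∈)))

flat-run : ∀ (P : ℕ → Set) {j₀ J} → (∀ j → j₀ ≤ j → j < J → P j → P (suc j)) →
           P j₀ → ∀ j → j₀ ≤ j → j ≤ J → P j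
flat-run P {j₀} {J} step Pj₀ j j₀≤j j≤J =
  subst P (m∸n+n≡m j₀≤j) (run (j ∸ j₀) (subst (_≤ J) (sym (m∸n+n≡m j₀≤j)) j≤J))
  where
  run : ∀ d → d + j₀ ≤ J → P (d + j₀)
  run zero    _ = Pj₀
  run (suc d) d+j₀<J = step (d + j₀) (m≤n+m j₀ d) d+j₀<J (run d (<⇒≤ d+j₀<J))

-- A counter that goes up at each vₖ and down at each uₖ, where v₀ < u₀ < v₁ < u₁ < …,
-- is raised exactly on the intervals (vₖ, uₖ].
module Alternating (P : ℕ → ℕ → Set) (v u : ℕ → ℕ) (v<u : ∀ k → v k < u k) (u<v : ∀ k → u k < v (suc k))
  (j₀ : ℕ)
  (up   : ∀ j c → j₀ ≤ j → (∃ λ k → v k ≡ j) → P j c → P (suc j) (suc c))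
  (down : ∀ j c → j₀ ≤ j → (∃ λ k → u k ≡ j) → P j (suc c) → P (suc j) c)
  (flat : ∀ j c → j₀ ≤ j → ¬ (∃ λ k → v k ≡ j) → ¬ (∃ λ k → u k ≡ j) → P j c → P (suc j) c) where

  private
    module V = StrictlyIncreasing v (λ k → <-trans (v<u k) (u<v k))
    module U = StrictlyIncreasing u (λ k → <-trans (u<v k) (v<u (suc k)))

    u<v′ : ∀ {k k′} → k < k′ → u k < v k′
    u<v′ {k} (s≤s k≤k′) = <-≤-trans (u<v k) (V.mono-≤ (s≤s k≤k′))

  Raised : ℕ → Set
  Raised j = ∃ λ k → v k < j × j ≤ u k

  private
    Invariant : ℕ → ℕ → Set
    Invariant c j = (Raised j × P j (suc c)) ⊎ (¬ Raised j × P j c)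

    raise : ∀ {j k} → v k ≡ j → Raised (suc j) × ¬ Raised j
    raise {k = k} refl = (k , ≤-refl , v<u k) , λ (k′ , v′<v , v≤u′) → by-index v′<v v≤u′ (<-cmp k′ k)
      where
      by-index : ∀ {k′} → v k′ < v k → v k ≤ u k′ → Tri (k′ < k) (k′ ≡ k) (k < k′) → ⊥
      by-index _     v≤u′ (tri< k′<k _ _) = <⇒≱ (u<v′ k′<k) v≤u′
      by-index v′<v  _    (tri≈ _ refl _) = <-irrefl refl v′<v
      by-index v′<v  _    (tri> _ _ k<k′) = <⇒≱ (V.mono-< k<k′) (<⇒≤ v′<v)

    lower : ∀ {j k} → u k ≡ j → Raised j × ¬ Raised (suc j)
    lower {k = k} refl = (k , v<u k , ≤-refl) , λ (k′ , v′≤u , u<u′) → by-index v′≤u u<u′ (<-cmp k′ k)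
      where
      by-index : ∀ {k′} → v k′ < suc (u k) → u k < u k′ → Tri (k′ < k) (k′ ≡ k) (k < k′) → ⊥
      by-index _    u<u′ (tri< k′<k _ _) = <⇒≱ (U.mono-< k′<k) (<⇒≤ u<u′)
      by-index _    u<u′ (tri≈ _ refl _) = <-irrefl refl u<u′
      by-index v′≤u _    (tri> _ _ k<k′) = <⇒≱ (u<v′ k<k′) (≤-pred v′≤u)

    keep : ∀ {j} → ¬ (∃ λ k → v k ≡ j) → ¬ (∃ λ k → u k ≡ j) →
           (Raised j → Raised (suc j)) × (Raised (suc j) → Raised j)
    keep ¬v ¬u = (λ (k , v<j , j≤u) → k , m≤n⇒m≤1+n v<j , ≤∧≢⇒< j≤u (λ j≡u → ¬u (k , sym j≡u))) ,
                 (λ (k , v<1+j , 1+j≤u) → k , ≤∧≢⇒< (≤-pred v<1+j) (λ v≡j → ¬v (k , v≡j)) , <⇒≤ 1+j≤u)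

    step : ∀ c j → j₀ ≤ j → Invariant c j → Invariant c (suc j)
    step c j j₀≤j inv with V.image? j | U.image? j | inv
    ... | yes (k , e) | _           | inj₁ (raised , _)  = contradiction raised (proj₂ (raise e))
    ... | yes (k , e) | _           | inj₂ (_ , Pj)      = inj₁ (proj₁ (raise e) , up j c j₀≤j (k , e) Pj)
    ... | no _        | yes (k , e) | inj₁ (_ , Pj)      = inj₂ (proj₂ (lower e) , down j c j₀≤j (k , e) Pj)
    ... | no _        | yes (k , e) | inj₂ (¬raised , _) = contradiction (proj₁ (lower e)) ¬raised
    ... | no ¬v       | no ¬u       | inj₁ (raised , Pj) =
      inj₁ (proj₁ (keep ¬v ¬u) raised , flat j (suc c) j₀≤j ¬v ¬u Pj)
    ... | no ¬v       | no ¬u       | inj₂ (¬raised , Pj) =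
      inj₂ (¬raised ∘′ proj₂ (keep ¬v ¬u) , flat j c j₀≤j ¬v ¬u Pj)

  counter : ∀ c → ¬ Raised j₀ → P j₀ c → ∀ j → j₀ ≤ j → (Raised j → P j (suc c)) × (¬ Raised j → P j c)
  counter c ¬raised Pj₀ j j₀≤j =
    read (flat-run (Invariant c) (λ i j₀≤i _ → step c i j₀≤i) (inj₂ (¬raised , Pj₀)) j j₀≤j ≤-refl)
    where
    read : Invariant c j → (Raised j → P j (suc c)) × (¬ Raised j → P j c)
    read (inj₁ (raised , Pj))  = (λ _ → Pj) , (λ ¬raised′ → contradiction raised ¬raised′)
    read (inj₂ (¬raised′ , Pj)) = (λ raised → contradiction raised ¬raised′) , (λ _ → Pj)

module Uβ (a b : ℕ) (1≤b : 1 ≤ b) (b<a∸1 : b < a ∸ 1) where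

  2+b≤a : 2 + b ≤ a
  2+b≤a = shift a b<a∸1
    where
    shift : ∀ n → b < n ∸ 1 → 2 + b ≤ n
    shift (suc n) b<n = s≤s b<n

  b<a : b < a
  b<a = ≤-trans (n≤1+n (suc b)) 2+b≤a

  1≤a : 1 ≤ a
  1≤a = ≤-trans (s≤s z≤n) b<a

  a∸1<a : a ∸ 1 < a
  a∸1<a = ∸-monoʳ-< (s≤s z≤n) 1≤a

  a≡1+a∸1 : a ≡ suc (a ∸ 1)
  a≡1+a∸1 = sym (m+[n∸m]≡n 1≤a)

  -- φ(s) = 0^(zrun s) 1
  zrun : Bool → ℕ
  zrun false = a
  zrun true  = b

  zrun≤a : ∀ s → zrun s ≤ a
  zrun≤a false = ≤-refl
  zrun≤a true  = <⇒≤ b<a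

  b≤zrun : ∀ s → b ≤ zrun s
  b≤zrun false = <⇒≤ b<a
  b≤zrun true  = ≤-refl

  zrun-injective : ∀ s t → zrun s ≡ zrun t → s ≡ t
  zrun-injective false false e = refl
  zrun-injective false true  e = ⊥-elim (<⇒≢ b<a (sym e))
  zrun-injective true  false e = ⊥-elim (<⇒≢ b<a e)
  zrun-injective true  true  e = refl

  Φ : Word → Word
  Φ = φ a b

  φ-∷ : ∀ s w → Φ (s ∷ w) ≡ zeros (zrun s) ++ true ∷ Φ w
  φ-∷ false w = ++-assoc (zeros a) [ true ] (Φ w)
  φ-∷ true  w = ++-assoc (zeros b) [ true ] (Φ w)

  φ-[_] : ∀ s → Φ [ s ] ≡ zeros (zrun s) ++ [ true ]
  φ-[ s ] = φ-∷ s []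

  φ-++ : ∀ x y → Φ (x ++ y) ≡ Φ x ++ Φ y
  φ-++ []      y = refl
  φ-++ (s ∷ x) y = begin
    Φ (s ∷ x ++ y)                             ≡⟨ φ-∷ s (x ++ y) ⟩
    zeros (zrun s) ++ true ∷ Φ (x ++ y)        ≡⟨ cong (λ z → zeros (zrun s) ++ true ∷ z) (φ-++ x y) ⟩
    zeros (zrun s) ++ true ∷ Φ x ++ Φ y        ≡⟨ sym (++-assoc (zeros (zrun s)) (true ∷ Φ x) (Φ y)) ⟩
    (zeros (zrun s) ++ true ∷ Φ x) ++ Φ y      ≡⟨ cong (_++ Φ y) (sym (φ-∷ s x)) ⟩
    Φ (s ∷ x) ++ Φ y                           ∎
    where open ≡-Reasoning

  φ-∷ʳ : ∀ w s → Φ (w ∷ʳ s) ≡ Φ w ++ zeros (zrun s) ++ [ true ]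
  φ-∷ʳ w s = trans (φ-++ w [ s ]) (cong (Φ w ++_) φ-[ s ])

  φ-empty-or-ends-with-1 : ∀ w → Φ w ≡ [] ⊎ ∃ λ Q → Φ w ≡ Q ∷ʳ true
  φ-empty-or-ends-with-1 w with initLast w
  ... | []       = inj₁ refl
  ... | v ∷ʳ′ s  = inj₂ (Φ v ++ zeros (zrun s) , trans (φ-∷ʳ v s) (sym (++-assoc (Φ v) (zeros (zrun s)) [ true ])))

  φ-split-at-1 : ∀ v P R → Φ v ≡ P ++ true ∷ R →
                 ∃₂ λ v₁ v₂ → v ≡ v₁ ++ v₂ × P ∷ʳ true ≡ Φ v₁ × R ≡ Φ v₂
  φ-split-at-1 []      []      R ()
  φ-split-at-1 []      (_ ∷ _) R ()
  φ-split-at-1 (s ∷ v) P R e with split-at-1 (zrun s) (Φ v) P R (trans (sym (φ-∷ s v)) e)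
  ... | inj₁ (refl , refl) = [ s ] , v , refl , sym φ-[ s ] , refl
  ... | inj₂ (P′ , refl , e′) with φ-split-at-1 v P′ R e′
  ...   | v₁ , v₂ , refl , P′1≡ , refl = s ∷ v₁ , v₂ , refl , (begin
    (zeros (zrun s) ++ true ∷ P′) ∷ʳ true    ≡⟨ ++-assoc (zeros (zrun s)) (true ∷ P′) [ true ] ⟩
    zeros (zrun s) ++ true ∷ P′ ++ [ true ]  ≡⟨ cong (λ z → zeros (zrun s) ++ true ∷ z) P′1≡ ⟩
    zeros (zrun s) ++ true ∷ Φ v₁            ≡⟨ sym (φ-∷ s v₁) ⟩
    Φ (s ∷ v₁)                               ∎) , refl
    where open ≡-Reasoning

  φ-∷-nonempty : ∀ s w → Φ (s ∷ w) ≢ []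
  φ-∷-nonempty s w e = ++-∷≢[] (zeros (zrun s)) (trans (sym (φ-∷ s w)) e)

  φ-prefix-code : ∀ q X v → Φ q ++ X ≡ Φ v → ∃ λ v′ → v ≡ q ++ v′ × X ≡ Φ v′
  φ-prefix-code []      X v       e = v , refl , e
  φ-prefix-code (s ∷ q) X []      e = ⊥-elim (φ-∷-nonempty s q (++-conicalˡ (Φ (s ∷ q)) X e))
  φ-prefix-code (s ∷ q) X (t ∷ v) e
    with zeros-1-injective (zrun s) (zrun t) (Φ q ++ X) (Φ v)
           (trans (sym (++-assoc (zeros (zrun s)) (true ∷ Φ q) X))
             (trans (cong (_++ X) (sym (φ-∷ s q))) (trans e (φ-∷ t v))))
  ... | s≡t , e′ with zrun-injective s t s≡t | φ-prefix-code q X v e′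
  ...   | refl | v′ , refl , X≡ = v′ , refl , X≡

  φ-injective : ∀ q r → Φ q ≡ Φ r → q ≡ r
  φ-injective q r e with φ-prefix-code q [] r (trans (++-identityʳ (Φ q)) e)
  ... | []      , r≡ , _  = trans (sym (++-identityʳ q)) (sym r≡)
  ... | s ∷ v′  , _  , e′ = ⊥-elim (φ-∷-nonempty s v′ (sym e′))

  φ-zero-run-≤a : ∀ v P k S → Φ v ≡ P ++ zeros k ++ S → k ≤ a
  φ-zero-run-≤a []      []      zero    S e = z≤n
  φ-zero-run-≤a (s ∷ v) P       k       S e with split-at-zeros (zrun s) k (Φ v) P S (trans (sym (φ-∷ s v)) e)
  ... | inj₁ k≤zrun         = ≤-trans k≤zrun (zrun≤a s)
  ... | inj₂ (P′ , _ , e′) = φ-zero-run-≤a v P′ k S e′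

  φ-isolated-zero-run : ∀ v P k S → Φ v ≡ P ++ true ∷ zeros k ++ true ∷ S → ∃ λ t → k ≡ zrun t
  φ-isolated-zero-run v P k S e with φ-split-at-1 v P (zeros k ++ true ∷ S) e
  ... | _ , t ∷ v₂ , _ , _ , e′ = t , proj₁ (zeros-1-injective k (zrun t) S (Φ v₂) (trans e′ (φ-∷ t v₂)))
  ... | _ , []     , _ , _ , e′ = ⊥-elim (++-∷≢[] (zeros k) e′)

  φ-zeros-before-boundary : ∀ v s P x → P ++ zeros x ≡ Φ v ++ zeros (zrun s) → x ≤ zrun s
  φ-zeros-before-boundary v s P x e with x ≤? zrun s
  ... | yes x≤ = x≤
  ... | no x≰ with longer-zeros-suffix x (zrun s) P (Φ v) e (≰⇒> x≰) | φ-empty-or-ends-with-1 v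
  ...   | Q′ , e′ | inj₁ e″ = ⊥-elim (++-∷≢[] Q′ (trans (sym e′) e″))
  ...   | Q′ , e′ | inj₂ (Q , e″) with ∷ʳ-injective Q′ Q (trans (sym e′) e″)
  ...     | _ , ()

  φ-desubstitute : ∀ v P x q y t′ S → Φ v ≡ P ++ zeros x ++ true ∷ Φ q ++ zeros y ++ t′ ∷ S →
                   ∃₂ λ s t → s ∷ q ++ [ t ] ⊑ v × x ≤ zrun s × y ≤ zrun t
  φ-desubstitute v P x q y t′ S e
    with φ-split-at-1 v (P ++ zeros x) (Φ q ++ zeros y ++ t′ ∷ S) (trans e (sym (++-assoc P (zeros x) _)))
  ... | v₁ , v₂ , refl , P0ˣ1≡ , e₂ with initLast v₁
  ...   | [] = ⊥-elim (++-∷≢[] (P ++ zeros x) P0ˣ1≡)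
  ...   | v₁′ ∷ʳ′ s with φ-prefix-code q (zeros y ++ t′ ∷ S) v₂ e₂
  ...     | []     , _    , e₃ = ⊥-elim (++-∷≢[] (zeros y) e₃)
  ...     | t ∷ v₄ , refl , e₃ =
    s , t , (v₁′ , v₄ , solve 5 (λ v₁′ s q t v₄ → (v₁′ ⊕ s) ⊕ q ⊕ t ⊕ v₄ ⊜ v₁′ ⊕ (s ⊕ q ⊕ t) ⊕ v₄)
                               refl v₁′ [ s ] q [ t ] v₄) ,
    φ-zeros-before-boundary v₁′ s P x (∷ʳ-injectiveˡ (P ++ zeros x) (Φ v₁′ ++ zeros (zrun s)) boundary) ,
    zeros-before-1 y (zrun t) (t′ ∷ S) (Φ v₄) (trans e₃ (φ-∷ t v₄))
    where
    boundary : (P ++ zeros x) ∷ʳ true ≡ (Φ v₁′ ++ zeros (zrun s)) ∷ʳ true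
    boundary = trans P0ˣ1≡ (trans (φ-∷ʳ v₁′ s) (sym (++-assoc (Φ v₁′) (zeros (zrun s)) [ true ])))

  Φ^ : ℕ → Word → Word
  Φ^ = φ^ a b

  Φ^-++ : ∀ n x y → Φ^ n (x ++ y) ≡ Φ^ n x ++ Φ^ n y
  Φ^-++ zero    x y = refl
  Φ^-++ (suc n) x y = trans (cong Φ (Φ^-++ n x y)) (φ-++ (Φ^ n x) (Φ^ n y))

  Φ^-suc : ∀ n w → Φ^ (suc n) w ≡ Φ^ n (Φ w)
  Φ^-suc zero    w = refl
  Φ^-suc (suc n) w = cong Φ (Φ^-suc n w)

  approx : ℕ → Word
  approx n = Φ^ n [ false ]

  -- φ(0) = 0 0 0^(a-2) 1 because a ≥ 2.
  approx-square-prefix : ∀ n → ∃ λ R → approx (suc n) ≡ approx n ++ approx n ++ R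
  approx-square-prefix n = Φ^ n rest , (begin
    Φ^ (suc n) [ false ]                       ≡⟨ Φ^-suc n [ false ] ⟩
    Φ^ n (Φ [ false ])                         ≡⟨ cong (Φ^ n) (trans φ-[ false ] (cong (λ k → zeros k ∷ʳ true) a≡2+a∸2)) ⟩
    Φ^ n ([ false ] ++ [ false ] ++ rest)      ≡⟨ Φ^-++ n [ false ] (false ∷ rest) ⟩
    approx n ++ Φ^ n ([ false ] ++ rest)       ≡⟨ cong (approx n ++_) (Φ^-++ n [ false ] rest) ⟩
    approx n ++ approx n ++ Φ^ n rest          ∎)
    where
    open ≡-Reasoning
    rest : Word
    rest = zeros (a ∸ 2) ++ [ true ]
    a≡2+a∸2 : a ≡ 2 + (a ∸ 2)
    a≡2+a∸2 = sym (m+[n∸m]≡n (≤-trans (s≤s (s≤s z≤n)) 2+b≤a))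

  approx-starts-with-0 : ∀ n → ∃ λ r → approx n ≡ false ∷ r
  approx-starts-with-0 zero = [] , refl
  approx-starts-with-0 (suc n) with approx-square-prefix n | approx-starts-with-0 n
  ... | R , e | r , e′ = r ++ approx n ++ R , trans e (cong (_++ approx n ++ R) e′)

  -- Equivalent to Factor (uβ a b) (ℒ⇒Factor, Factor⇒ℒ) but phrased with the finite words φⁿ(0).
  ℒ : Word → Set
  ℒ w = ∃ λ n → w ⊑ approx n

  ℒ-⊑ : ∀ {w v} → w ⊑ v → ℒ v → ℒ w
  ℒ-⊑ w⊑v (n , v⊑) = n , ⊑-trans w⊑v v⊑

  ℒ-φ : ∀ {w} → ℒ w → ℒ (Φ w)
  ℒ-φ {w} (n , p , s , e) = suc n , Φ p , Φ s , (begin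
    approx (suc n)          ≡⟨ cong Φ e ⟩
    Φ (p ++ w ++ s)         ≡⟨ φ-++ p (w ++ s) ⟩
    Φ p ++ Φ (w ++ s)       ≡⟨ cong (Φ p ++_) (φ-++ w s) ⟩
    Φ p ++ Φ w ++ Φ s       ∎)
    where open ≡-Reasoning

  ⊑-approx-suc : ∀ {w} n → w ⊑ approx n → w ⊑ approx (suc n)
  ⊑-approx-suc n w⊑ = let (R , e) = approx-square-prefix n in ⊑-trans w⊑ ([] , approx n ++ R , e)

  ℒ-extendʳ : ∀ {w} → ℒ w → ∃ λ t → ℒ (w ∷ʳ t)
  ℒ-extendʳ {w} (n , p , t ∷ s , e) =
    t , n , p , s , trans e (solve 4 (λ p w t s → p ⊕ w ⊕ t ⊕ s ⊜ p ⊕ (w ⊕ t) ⊕ s) refl p w [ t ] s)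
  ℒ-extendʳ {w} (n , p , [] , e) with approx-square-prefix n | approx-starts-with-0 n
  ... | R , eR | r , er = false , suc n , p , r ++ R , (begin
    approx (suc n)                      ≡⟨ eR ⟩
    approx n ++ approx n ++ R           ≡⟨ cong₂ (λ x y → x ++ y ++ R) e er ⟩
    (p ++ w ++ []) ++ (false ∷ r) ++ R
      ≡⟨ solve 5 (λ p w f r R → (p ⊕ w ⊕ id) ⊕ (f ⊕ r) ⊕ R ⊜ p ⊕ (w ⊕ f) ⊕ r ⊕ R) refl p w [ false ] r R ⟩
    p ++ (w ∷ʳ false) ++ r ++ R         ∎)
    where open ≡-Reasoning

  ℒ-extendˡ : ∀ {w} → ℒ w → ∃ λ s → ℒ (s ∷ w)
  ℒ-extendˡ {w} (n , p , s , e) with approx-square-prefix n | approx-starts-with-0 n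
  ... | R , eR | r , er with ∷-as-∷ʳ false (r ++ p)
  ...   | ys , y , e′ = y , suc n , ys , s ++ R , (begin
    approx (suc n)                      ≡⟨ eR ⟩
    approx n ++ approx n ++ R           ≡⟨ cong₂ (λ x z → x ++ z ++ R) er e ⟩
    (false ∷ r) ++ (p ++ w ++ s) ++ R
      ≡⟨ solve 5 (λ fr p w s R → fr ⊕ (p ⊕ w ⊕ s) ⊕ R ⊜ (fr ⊕ p) ⊕ w ⊕ s ⊕ R) refl (false ∷ r) p w s R ⟩
    (false ∷ r ++ p) ++ w ++ s ++ R     ≡⟨ cong (_++ w ++ s ++ R) e′ ⟩
    (ys ∷ʳ y) ++ w ++ s ++ R            ≡⟨ ++-assoc ys [ y ] (w ++ s ++ R) ⟩
    ys ++ (y ∷ w) ++ s ++ R             ∎)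
    where open ≡-Reasoning

  ℒ-extend : ∀ {w} → ℒ w → ∃₂ λ s t → ℒ (s ∷ w ++ [ t ])
  ℒ-extend ℒw with ℒ-extendˡ ℒw
  ... | s , ℒsw with ℒ-extendʳ ℒsw
  ...   | t , ℒswt = s , t , ℒswt

  -- T′ b q b is T(q) of the paper.
  T′ : ℕ → Word → ℕ → Word
  T′ x q y = zeros x ++ true ∷ Φ q ++ zeros y

  Desubstitution : ℕ → Word → ℕ → Set
  Desubstitution x q y = ∃₂ λ s t → ℒ (s ∷ q ++ [ t ]) × x ≤ zrun s × y ≤ zrun t

  -- The extra letter t′ delimits the trailing 0^y; approx (suc n) is Φ (approx n) by definition.
  ℒ-desubstitute : ∀ x q y → ℒ (T′ x q y) → Desubstitution x q y
  ℒ-desubstitute x q y ℒT with ℒ-extendʳ ℒT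
  ... | t′ , n , ℒTt′ with ⊑-approx-suc n ℒTt′
  ...   | p , S , e with φ-desubstitute (approx n) p x q y t′ S
                          (trans e (solve 6 (λ p x q y t′ S → p ⊕ ((x ⊕ q ⊕ y) ⊕ t′) ⊕ S ⊜ p ⊕ x ⊕ q ⊕ y ⊕ t′ ⊕ S)
                                       refl p (zeros x) (true ∷ Φ q) (zeros y) [ t′ ] S))
  ...     | s , t , sqt⊑ , x≤ , y≤ = s , t , (n , sqt⊑) , x≤ , y≤

  ℒ-substitute : ∀ x q y → Desubstitution x q y → ℒ (T′ x q y)
  ℒ-substitute x q y (s , t , ℒsqt , x≤ , y≤) = ℒ-⊑ T′⊑ (ℒ-φ ℒsqt)
    where
    open ≡-Reasoning
    T′⊑ : T′ x q y ⊑ Φ (s ∷ q ++ [ t ])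
    T′⊑ = zeros (zrun s ∸ x) , zeros (zrun t ∸ y) ++ [ true ] , (begin
      Φ (s ∷ q ++ [ t ])                                      ≡⟨ φ-∷ s (q ++ [ t ]) ⟩
      zeros (zrun s) ++ true ∷ Φ (q ++ [ t ])                 ≡⟨ cong (λ z → zeros (zrun s) ++ true ∷ z) (φ-∷ʳ q t) ⟩
      zeros (zrun s) ++ true ∷ Φ q ++ zeros (zrun t) ++ [ true ]
        ≡⟨ cong₂ (λ z₁ z₂ → z₁ ++ true ∷ Φ q ++ z₂ ++ [ true ])
             (trans (cong zeros (sym (m∸n+n≡m x≤))) (zeros-+ (zrun s ∸ x) x))
             (trans (cong zeros (sym (m+[n∸m]≡n y≤))) (zeros-+ y (zrun t ∸ y))) ⟩
      (zeros (zrun s ∸ x) ++ zeros x) ++ true ∷ Φ q ++ (zeros y ++ zeros (zrun t ∸ y)) ++ [ true ]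
        ≡⟨ solve 6 (λ z₁ z₂ 1Φq z₃ z₄ 1′ → (z₁ ⊕ z₂) ⊕ 1Φq ⊕ (z₃ ⊕ z₄) ⊕ 1′ ⊜ z₁ ⊕ (z₂ ⊕ 1Φq ⊕ z₃) ⊕ z₄ ⊕ 1′)
             refl (zeros (zrun s ∸ x)) (zeros x) (true ∷ Φ q) (zeros y) (zeros (zrun t ∸ y)) [ true ] ⟩
      zeros (zrun s ∸ x) ++ T′ x q y ++ zeros (zrun t ∸ y) ++ [ true ] ∎)

  ℒ-T′-inner : ∀ {x q y} → ℒ (T′ x q y) → ℒ q
  ℒ-T′-inner {x} {q} {y} ℒw = let (s , t , ℒsqt , _) = ℒ-desubstitute x q y ℒw in ℒ-⊑ (⊑-wrap s t) ℒsqt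

  ℒ-T′-≤b : ∀ {x q y} → x ≤ b → y ≤ b → ℒ q → ℒ (T′ x q y)
  ℒ-T′-≤b {x} {q} {y} x≤b y≤b ℒq =
    let (s , t , ℒsqt) = ℒ-extend ℒq
    in ℒ-substitute x q y (s , t , ℒsqt , ≤-trans x≤b (b≤zrun s) , ≤-trans y≤b (b≤zrun t))

  ℒ-zeros⇒≤a : ∀ k → ℒ (zeros k) → k ≤ a
  ℒ-zeros⇒≤a k (n , ℒ0ᵏ) with ⊑-approx-suc n ℒ0ᵏ
  ... | p , s , e = φ-zero-run-≤a (approx n) p k s e

  ℒ-isolated-zero-run : ∀ k → ℒ (true ∷ zeros k ++ [ true ]) → ∃ λ t → k ≡ zrun t
  ℒ-isolated-zero-run k (n , ℒ10ᵏ1) with ⊑-approx-suc n ℒ10ᵏ1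
  ... | p , s , e = φ-isolated-zero-run (approx n) p k s
                      (trans e (cong (λ z → p ++ true ∷ z) (++-assoc (zeros k) [ true ] s)))

  ℒ-zeros : ∀ k → k ≤ a → ℒ (zeros k)
  ℒ-zeros k k≤a = 1 , [] , zeros (a ∸ k) ++ [ true ] , (begin
    Φ [ false ]                          ≡⟨ φ-[ false ] ⟩
    zeros a ++ [ true ]                  ≡⟨ cong (λ z → zeros z ++ [ true ]) (sym (m+[n∸m]≡n k≤a)) ⟩
    zeros (k + (a ∸ k)) ++ [ true ]      ≡⟨ cong (_++ [ true ]) (zeros-+ k (a ∸ k)) ⟩
    (zeros k ++ zeros (a ∸ k)) ++ [ true ] ≡⟨ ++-assoc (zeros k) _ _ ⟩
    zeros k ++ zeros (a ∸ k) ++ [ true ] ∎)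
    where open ≡-Reasoning

  ℒ-letter : ∀ s → ℒ [ s ]
  ℒ-letter false = 0 , [] , [] , refl
  ℒ-letter true  = 1 , zeros a , [] , φ-[ false ]

  ℒ-[] : ℒ []
  ℒ-[] = 0 , [] , [ false ] , refl

  approx-prefix-mono : ∀ m d → ∃ λ R → approx (d + m) ≡ approx m ++ R
  approx-prefix-mono m zero    = [] , sym (++-identityʳ _)
  approx-prefix-mono m (suc d) with approx-prefix-mono m d | approx-square-prefix (d + m)
  ... | R , e | R′ , e′ = R ++ approx (d + m) ++ R′ ,
    trans e′ (trans (cong (_++ approx (d + m) ++ R′) e) (++-assoc (approx m) R _))

  length-approx : ∀ n → n < length (approx n)
  length-approx zero    = s≤s z≤n
  length-approx (suc n) with approx-square-prefix n | approx-starts-with-0 n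
  ... | R , e | r , e′ = begin-strict
    suc n                                         <⟨ s≤s (length-approx n) ⟩
    suc (length (approx n))                       ≡⟨ +-comm 1 _ ⟩
    length (approx n) + 1                         ≤⟨ +-monoʳ-≤ (length (approx n)) 1≤ ⟩
    length (approx n) + length (approx n ++ R)    ≡⟨ sym (length-++ (approx n)) ⟩
    length (approx n ++ approx n ++ R)            ≡⟨ cong length (sym e) ⟩
    length (approx (suc n))                       ∎
    where
    open ≤-Reasoning
    1≤ : 1 ≤ length (approx n ++ R)
    1≤ rewrite e′ = s≤s z≤n

  uβ-approx : ∀ n k → k < length (approx n) → uβ a b k ≡ nth (approx n) k
  uβ-approx n k k<n with ≤-total n (suc k)
  ... | inj₁ n≤1+k with approx-prefix-mono n (suc k ∸ n)
  ...   | R , e = begin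
    nth (approx (suc k)) k                 ≡⟨ cong (λ z → nth (approx z) k) (sym (m∸n+n≡m n≤1+k)) ⟩
    nth (approx (suc k ∸ n + n)) k         ≡⟨ cong (λ z → nth z k) e ⟩
    nth (approx n ++ R) k                  ≡⟨ nth-++ˡ (approx n) R k k<n ⟩
    nth (approx n) k                       ∎
    where open ≡-Reasoning
  uβ-approx n k k<n | inj₂ 1+k≤n with approx-prefix-mono (suc k) (n ∸ suc k)
  ...   | R , e = begin
    nth (approx (suc k)) k                 ≡⟨ sym (nth-++ˡ (approx (suc k)) R k (<-trans (n<1+n k) (length-approx _))) ⟩
    nth (approx (suc k) ++ R) k            ≡⟨ cong (λ z → nth z k) (sym e) ⟩
    nth (approx (n ∸ suc k + suc k)) k     ≡⟨ cong (λ z → nth (approx z) k) (m∸n+n≡m 1+k≤n) ⟩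
    nth (approx n) k                       ∎
    where open ≡-Reasoning

  window-approx : ∀ n i m → i + m ≤ length (approx n) → window (uβ a b) i m ≡ take m (drop i (approx n))
  window-approx n i m i+m≤ = trans (map-upTo (λ j → uβ a b (i + j)) m)
    (applyUpTo-nth (approx n) i m (λ j → uβ a b (i + j)) i+m≤
      (λ j j<m → uβ-approx n (i + j) (<-≤-trans (+-monoʳ-< i j<m) i+m≤)))

  ℒ⇒Factor : ∀ {w} → ℒ w → Factor (uβ a b) w
  ℒ⇒Factor {w} (n , p , s , e) = length p , (begin
    window (uβ a b) (length p) (length w)            ≡⟨ window-approx n (length p) (length w) (occurrence-bound p w s e) ⟩
    take (length w) (drop (length p) (approx n))     ≡⟨ cong (λ z → take (length w) (drop (length p) z)) e ⟩
    take (length w) (drop (length p) (p ++ w ++ s))  ≡⟨ take-drop-++ p w s ⟩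
    w                                                ∎)
    where open ≡-Reasoning

  Factor⇒ℒ : ∀ {w} → Factor (uβ a b) w → ℒ w
  Factor⇒ℒ {w} (i , e) = i + m , take i v , drop m (drop i v) , (begin
    v                                                ≡⟨ sym (take++drop≡id i v) ⟩
    take i v ++ drop i v                             ≡⟨ cong (take i v ++_) (sym (take++drop≡id m (drop i v))) ⟩
    take i v ++ take m (drop i v) ++ drop m (drop i v) ≡⟨ cong (λ z → take i v ++ z ++ drop m (drop i v)) w≡ ⟩
    take i v ++ w ++ drop m (drop i v)               ∎)
    where
    open ≡-Reasoning
    m : ℕ
    m = length w
    v : Word
    v = approx (i + m)
    w≡ : take m (drop i v) ≡ w
    w≡ = trans (sym (window-approx (i + m) i m (<⇒≤ (length-approx (i + m))))) e

  -- Reading 1 0^j r from left to right, every 1 of r closes an isolated run 0^(zrun t).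
  ℒ-after-1 : ∀ j r → ℒ (true ∷ zeros j ++ r) → ∃₂ λ q y → zeros j ++ r ≡ Φ q ++ zeros y
  ℒ-after-1 j []          _   = [] , j , ++-identityʳ (zeros j)
  ℒ-after-1 j (false ∷ r) ℒw with ℒ-after-1 (suc j) r (subst (λ z → ℒ (true ∷ z)) (zeros-suc j r) ℒw)
  ... | q , y , e = q , y , trans (zeros-suc j r) e
  ℒ-after-1 j (true ∷ r)  ℒw
    with ℒ-isolated-zero-run j (ℒ-⊑ ([] , r , cong (true ∷_) (sym (++-assoc (zeros j) [ true ] r))) ℒw)
       | ℒ-after-1 0 r (ℒ-⊑ (true ∷ zeros j , [] , cong (λ z → true ∷ zeros j ++ true ∷ z) (sym (++-identityʳ r)))
                           ℒw)
  ... | t , refl | q , y , e = t ∷ q , y , (begin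
    zeros (zrun t) ++ true ∷ r               ≡⟨ cong (λ z → zeros (zrun t) ++ true ∷ z) e ⟩
    zeros (zrun t) ++ true ∷ Φ q ++ zeros y  ≡⟨ sym (++-assoc (zeros (zrun t)) (true ∷ Φ q) (zeros y)) ⟩
    (zeros (zrun t) ++ true ∷ Φ q) ++ zeros y ≡⟨ cong (_++ zeros y) (sym (φ-∷ t q)) ⟩
    Φ (t ∷ q) ++ zeros y                     ∎)
    where open ≡-Reasoning

  ℒ-shape : ∀ w → ℒ w → (∃ λ k → w ≡ zeros k) ⊎ (∃₂ λ x q → ∃ λ y → w ≡ T′ x q y)
  ℒ-shape w ℒw with zeros-or-first-1 w
  ... | inj₁ w≡0ᵏ = inj₁ w≡0ᵏ
  ... | inj₂ (x , r , refl)
    with ℒ-after-1 0 r (ℒ-⊑ (zeros x , [] , cong (λ z → zeros x ++ true ∷ z) (sym (++-identityʳ r))) ℒw)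
  ...   | q , y , e = inj₂ (x , q , y , cong (λ z → zeros x ++ true ∷ z) e)

  reverse-1φ : ∀ q → reverse (true ∷ Φ q) ≡ true ∷ Φ (reverse q)
  reverse-1φ []      = refl
  reverse-1φ (s ∷ q) = begin
    reverse (true ∷ Φ (s ∷ q))                                  ≡⟨ cong (λ z → reverse (true ∷ z)) (φ-∷ s q) ⟩
    reverse ((true ∷ zeros (zrun s)) ++ true ∷ Φ q)             ≡⟨ reverse-++ (true ∷ zeros (zrun s)) (true ∷ Φ q) ⟩
    reverse (true ∷ Φ q) ++ reverse (true ∷ zeros (zrun s))     ≡⟨ cong₂ _++_ (reverse-1φ q) (reverse-1zeros (zrun s)) ⟩
    (true ∷ Φ (reverse q)) ++ (zeros (zrun s) ∷ʳ true)          ≡⟨ cong (true ∷_) (sym (φ-∷ʳ (reverse q) s)) ⟩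
    true ∷ Φ (reverse q ∷ʳ s)                                   ≡⟨ cong (λ z → true ∷ Φ z) (sym (unfold-reverse s q)) ⟩
    true ∷ Φ (reverse (s ∷ q))                                  ∎
    where
    open ≡-Reasoning
    reverse-1zeros : ∀ k → reverse (true ∷ zeros k) ≡ zeros k ∷ʳ true
    reverse-1zeros k = trans (unfold-reverse true (zeros k)) (cong (_∷ʳ true) (reverse-zeros k))

  reverse-T′ : ∀ x q y → reverse (T′ x q y) ≡ T′ y (reverse q) x
  reverse-T′ x q y = begin
    reverse (zeros x ++ (true ∷ Φ q) ++ zeros y)
      ≡⟨ reverse-++³ (zeros x) (true ∷ Φ q) (zeros y) ⟩
    reverse (zeros y) ++ reverse (true ∷ Φ q) ++ reverse (zeros x)
      ≡⟨ cong₂ (λ z₁ z₂ → z₁ ++ z₂ ++ reverse (zeros x)) (reverse-zeros y) (reverse-1φ q) ⟩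
    zeros y ++ (true ∷ Φ (reverse q)) ++ reverse (zeros x)
      ≡⟨ cong (λ z → zeros y ++ true ∷ Φ (reverse q) ++ z) (reverse-zeros x) ⟩
    T′ y (reverse q) x
      ∎
    where open ≡-Reasoning

  T′-injective : ∀ {x q x′ q′} y → T′ x q y ≡ T′ x′ q′ y → x ≡ x′ × q ≡ q′
  T′-injective {x} {q} {x′} {q′} y e with zeros-1-injective x x′ _ _ e
  ... | x≡x′ , e′ = x≡x′ , φ-injective q q′ (++-cancelʳ (zeros y) (Φ q) (Φ q′) e′)

  T′-palindrome⇒ : ∀ x q y → Palindrome (T′ x q y) → y ≡ x × Palindrome q
  T′-palindrome⇒ x q y T′≡ with zeros-1-injective x y _ _ (trans T′≡ (reverse-T′ x q y))
  ... | refl , e = refl , φ-injective q (reverse q) (++-cancelʳ (zeros x) (Φ q) (Φ (reverse q)) e)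

  T′-palindrome⇐ : ∀ x q → Palindrome q → Palindrome (T′ x q x)
  T′-palindrome⇐ x q q≡ = sym (trans (reverse-T′ x q x) (cong (λ z → T′ x z x) (sym q≡)))

  wrap0-zeros : ∀ k → wrap false (zeros k) ≡ zeros (2 + k)
  wrap0-zeros k = cong (false ∷_) (zeros-∷ʳ k)

  wrap1-zeros : ∀ r → wrap true (zeros (zrun r)) ≡ T′ 0 [ r ] 0
  wrap1-zeros r = cong (true ∷_) (trans (sym φ-[ r ]) (sym (++-identityʳ _)))

  wrap0-T′ : ∀ x q → wrap false (T′ x q x) ≡ T′ (suc x) q (suc x)
  wrap0-T′ x q = cong (false ∷_) (begin
    (zeros x ++ true ∷ Φ q ++ zeros x) ∷ʳ false
      ≡⟨ solve 4 (λ z t q f → (z ⊕ t ⊕ q ⊕ z) ⊕ f ⊜ z ⊕ t ⊕ q ⊕ z ⊕ f) refl (zeros x) [ true ] (Φ q) [ false ] ⟩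
    zeros x ++ true ∷ Φ q ++ (zeros x ∷ʳ false)
      ≡⟨ cong (λ z → zeros x ++ true ∷ Φ q ++ z) (zeros-∷ʳ x) ⟩
    zeros x ++ true ∷ Φ q ++ zeros (suc x)
      ∎)
    where open ≡-Reasoning

  wrap1-T′ : ∀ r q → wrap true (T′ (zrun r) q (zrun r)) ≡ T′ 0 (wrap r q) 0
  wrap1-T′ r q = cong (true ∷_) (begin
    (z ++ true ∷ Φ q ++ z) ∷ʳ true
      ≡⟨ solve 4 (λ z t q f → (z ⊕ t ⊕ q ⊕ z) ⊕ f ⊜ z ⊕ t ⊕ q ⊕ z ⊕ f) refl z [ true ] (Φ q) [ true ] ⟩
    z ++ true ∷ Φ q ++ z ++ [ true ]     ≡⟨ cong (λ w → z ++ true ∷ w) (sym (φ-∷ʳ q r)) ⟩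
    z ++ true ∷ Φ (q ∷ʳ r)               ≡⟨ sym (φ-∷ r (q ∷ʳ r)) ⟩
    Φ (wrap r q)                         ≡⟨ sym (++-identityʳ _) ⟩
    Φ (wrap r q) ++ zeros 0              ∎)
    where
    open ≡-Reasoning
    z : Word
    z = zeros (zrun r)

  T-orbit : ℕ → ℕ → Word
  T-orbit k zero    = zeros k
  T-orbit k (suc n) = T′ b (T-orbit k n) b

  InOrbit : ℕ → Word → Set
  InOrbit k w = ∃ λ n → w ≡ T-orbit k n

  V≡T-orbit : ∀ n → V a b (suc n) ≡ T-orbit b n
  V≡T-orbit zero    = refl
  V≡T-orbit (suc n) = cong (λ w → T′ b w b) (V≡T-orbit n)

  U≡T-orbit : ∀ n → U a b (suc n) ≡ T-orbit (a ∸ 1) n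
  U≡T-orbit zero    = refl
  U≡T-orbit (suc n) = cong (λ w → T′ b w b) (U≡T-orbit n)

  InOrbit-zeros : ∀ {k j} → InOrbit k (zeros j) → j ≡ k
  InOrbit-zeros {k} {j} (zero  , e) = zeros-injective e
  InOrbit-zeros {k} {j} (suc n , e) = ⊥-elim (zeros≢zeros-1 j b _ e)

  InOrbit-T′ : ∀ {k x q} → InOrbit k (T′ x q x) → x ≡ b × InOrbit k q
  InOrbit-T′ {k} {x} (zero  , e) = ⊥-elim (zeros≢zeros-1 k x _ (sym e))
  InOrbit-T′ {k} {x} (suc n , e) with zeros-1-injective x b _ _ e
  ... | refl , _ = refl , n , proj₂ (T′-injective b e)

  InOrbit-T : ∀ {k q} → InOrbit k q → InOrbit k (T′ b q b)
  InOrbit-T (n , refl) = suc n , refl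

  T-orbit-palindrome : ∀ k n → Palindrome (T-orbit k n)
  T-orbit-palindrome k zero    = sym (reverse-zeros k)
  T-orbit-palindrome k (suc n) = T′-palindrome⇐ b (T-orbit k n) (T-orbit-palindrome k n)

  ℒ-T-orbit : ∀ {k} n → k ≤ a → ℒ (T-orbit k n)
  ℒ-T-orbit zero    k≤a = ℒ-zeros _ k≤a
  ℒ-T-orbit (suc n) k≤a = ℒ-T′-≤b ≤-refl ≤-refl (ℒ-T-orbit n k≤a)

  ℒ-wrap0-zeros : ∀ k → ℒ (wrap false (zeros k)) ⇔ 2 + k ≤ a
  ℒ-wrap0-zeros k = mk⇔ (ℒ-zeros⇒≤a (2 + k) ∘ subst ℒ (wrap0-zeros k))
                        (subst ℒ (sym (wrap0-zeros k)) ∘ ℒ-zeros (2 + k))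

  ℒ-wrap1-zeros : ∀ k → ℒ (wrap true (zeros k)) ⇔ ∃ λ r → k ≡ zrun r
  ℒ-wrap1-zeros k = mk⇔ (ℒ-isolated-zero-run k)
                        (λ { (r , refl) → subst ℒ (sym (wrap1-zeros r)) (ℒ-T′-≤b z≤n z≤n (ℒ-letter r)) })

  ℒ-wrap0-T′ : ∀ x q → ℒ (wrap false (T′ x q x)) ⇔ Desubstitution (suc x) q (suc x)
  ℒ-wrap0-T′ x q = mk⇔ (ℒ-desubstitute (suc x) q (suc x) ∘ subst ℒ (wrap0-T′ x q))
                       (subst ℒ (sym (wrap0-T′ x q)) ∘ ℒ-substitute (suc x) q (suc x))

  isolated-run⊑wrap1-T′ : ∀ x q y → true ∷ zeros x ++ [ true ] ⊑ wrap true (T′ x q y)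
  isolated-run⊑wrap1-T′ x q y = [] , Φ q ++ zeros y ++ [ true ] , cong (true ∷_)
    (solve 4 (λ z t q z′ → (z ⊕ t ⊕ q ⊕ z′) ⊕ t ⊜ (z ⊕ t) ⊕ q ⊕ z′ ⊕ t) refl (zeros x) [ true ] (Φ q) (zeros y))

  ℒ-wrap1-T′ : ∀ x q → ℒ (wrap true (T′ x q x)) ⇔ ∃ λ r → x ≡ zrun r × ℒ (wrap r q)
  ℒ-wrap1-T′ x q = mk⇔ (λ ℒw → desubstituted ℒw (ℒ-isolated-zero-run x (ℒ-⊑ (isolated-run⊑wrap1-T′ x q x) ℒw)))
                       (λ { (r , refl , ℒrqr) → subst ℒ (sym (wrap1-T′ r q)) (ℒ-T′-≤b z≤n z≤n ℒrqr) })
    where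
    desubstituted : ℒ (wrap true (T′ x q x)) → (∃ λ r → x ≡ zrun r) → ∃ λ r → x ≡ zrun r × ℒ (wrap r q)
    desubstituted ℒw (r , x≡r) =
      r , x≡r , ℒ-T′-inner {0} {wrap r q} {0}
                  (subst ℒ (trans (cong (λ z → wrap true (T′ z q z)) x≡r) (wrap1-T′ r q)) ℒw)

  b<zrun⇒false : ∀ {s} → b < zrun s → s ≡ false
  b<zrun⇒false {false} _   = refl
  b<zrun⇒false {true}  b<b = ⊥-elim (<-irrefl refl b<b)

  ℒ-wrap-T : ∀ s q → ℒ (wrap s (T′ b q b)) ⇔ ℒ (wrap s q)
  ℒ-wrap-T false q = mk⇔ (desubstituted ∘ to (ℒ-wrap0-T′ b q))
                         (λ ℒ0q0 → from (ℒ-wrap0-T′ b q) (false , false , ℒ0q0 , b<a , b<a))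
    where
    desubstituted : Desubstitution (suc b) q (suc b) → ℒ (wrap false q)
    desubstituted (s , t , ℒsqt , b<s , b<t) with b<zrun⇒false b<s | b<zrun⇒false b<t
    ... | refl | refl = ℒsqt
  ℒ-wrap-T true q = mk⇔ (desubstituted ∘ to (ℒ-wrap1-T′ b q))
                        (λ ℒ1q1 → from (ℒ-wrap1-T′ b q) (true , refl , ℒ1q1))
    where
    desubstituted : (∃ λ r → b ≡ zrun r × ℒ (wrap r q)) → ℒ (wrap true q)
    desubstituted (r , b≡r , ℒrqr) with zrun-injective true r b≡r
    ... | refl = ℒrqr

  -- Which of the palindromic extensions 0w0, 1w1 of a palindromic factor w are factors:
  -- both exactly on the T-orbit of 0^b (the V^(n)), none exactly on that of 0^(a-1)
  -- (the U^(n)), and exactly one otherwise.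
  data Extensions (w : Word) : Set where
    both : InOrbit b w → ℒ (wrap false w) → ℒ (wrap true w) → Extensions w
    none : InOrbit (a ∸ 1) w → ¬ ℒ (wrap false w) → ¬ ℒ (wrap true w) → Extensions w
    one  : ∀ s → ¬ InOrbit b w → ¬ InOrbit (a ∸ 1) w → ℒ (wrap s w) → ¬ ℒ (wrap (not s) w) → Extensions w

  a∸1≢zrun : ∀ r → a ∸ 1 ≢ zrun r
  a∸1≢zrun false e = 1+n≰n (≤-reflexive (trans (sym a≡1+a∸1) (sym e)))
  a∸1≢zrun true  e = <-irrefl (sym e) b<a∸1

  2+a∸1≰a : ¬ (2 + (a ∸ 1) ≤ a)
  2+a∸1≰a 2+a∸1≤a = 1+n≰n (≤-pred (subst (2 + (a ∸ 1) ≤_) a≡1+a∸1 2+a∸1≤a))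

  extensions-zeros : ∀ k → k ≤ a → Extensions (zeros k)
  extensions-zeros k k≤a with k ≟ b | k ≟ a ∸ 1 | k ≟ a
  ... | yes refl | _ | _ =
    both (0 , refl) (from (ℒ-wrap0-zeros b) 2+b≤a) (from (ℒ-wrap1-zeros b) (true , refl))
  ... | no k≢b | yes refl | _ =
    none (0 , refl) (2+a∸1≰a ∘ to (ℒ-wrap0-zeros (a ∸ 1)))
         (λ ℒw → a∸1≢zrun _ (proj₂ (to (ℒ-wrap1-zeros (a ∸ 1)) ℒw)))
  ... | no k≢b | no k≢a∸1 | yes refl =
    one true (k≢b ∘ InOrbit-zeros) (k≢a∸1 ∘ InOrbit-zeros)
      (from (ℒ-wrap1-zeros a) (false , refl)) (λ ℒw → 1+n≰n (≤-trans (n≤1+n _) (to (ℒ-wrap0-zeros a) ℒw)))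
  ... | no k≢b | no k≢a∸1 | no k≢a =
    one false (k≢b ∘ InOrbit-zeros) (k≢a∸1 ∘ InOrbit-zeros) (from (ℒ-wrap0-zeros k) 2+k≤a) no-isolated-run
    where
    2+k≤a : 2 + k ≤ a
    2+k≤a with m≤n⇒m<n∨m≡n (≤∧≢⇒< k≤a k≢a)
    ... | inj₁ 2+k≤a  = 2+k≤a
    ... | inj₂ 1+k≡a = ⊥-elim (k≢a∸1 (cong (_∸ 1) 1+k≡a))
    no-isolated-run : ¬ ℒ (wrap true (zeros k))
    no-isolated-run ℒw with to (ℒ-wrap1-zeros k) ℒw
    ... | false , k≡a = k≢a k≡a
    ... | true  , k≡b = k≢b k≡b

  extensions-T : ∀ {q} → Extensions q → Extensions (T′ b q b)
  extensions-T (both o ℒ0 ℒ1) = both (InOrbit-T o) (from (ℒ-wrap-T false _) ℒ0) (from (ℒ-wrap-T true _) ℒ1)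
  extensions-T (none o ¬ℒ0 ¬ℒ1) = none (InOrbit-T o) (¬ℒ0 ∘ to (ℒ-wrap-T false _)) (¬ℒ1 ∘ to (ℒ-wrap-T true _))
  extensions-T (one s ¬V ¬U ℒs ¬ℒ¬s) =
    one s (¬V ∘ proj₂ ∘ InOrbit-T′) (¬U ∘ proj₂ ∘ InOrbit-T′)
          (from (ℒ-wrap-T s _) ℒs) (¬ℒ¬s ∘ to (ℒ-wrap-T (not s) _))

  extensions-T′ : ∀ x q → ℒ (T′ x q x) → x ≢ b → Extensions (T′ x q x)
  extensions-T′ x q ℒw x≢b = compare-with-b (ℒ-desubstitute x q x ℒw) (<-cmp x b)
    where
    ¬orbit : ∀ {k} → ¬ InOrbit k (T′ x q x)
    ¬orbit o = x≢b (proj₁ (InOrbit-T′ {x = x} {q} o))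
    no-isolated-run : (∀ r → x ≢ zrun r) → ¬ ℒ (wrap true (T′ x q x))
    no-isolated-run x≢zrun ℒw₁ = let (r , x≡r , _) = to (ℒ-wrap1-T′ x q) ℒw₁ in x≢zrun r x≡r
    compare-with-b : Desubstitution x q x → Tri (x < b) (x ≡ b) (b < x) → Extensions (T′ x q x)
    compare-with-b (s , t , ℒsqt , _ , _) (tri< x<b _ _) =
      one false ¬orbit ¬orbit
        (from (ℒ-wrap0-T′ x q) (s , t , ℒsqt , <-≤-trans x<b (b≤zrun s) , <-≤-trans x<b (b≤zrun t)))
        (no-isolated-run (λ r x≡r → <⇒≱ x<b (subst (b ≤_) (sym x≡r) (b≤zrun r))))
    compare-with-b _ (tri≈ _ x≡b _) = ⊥-elim (x≢b x≡b)
    compare-with-b (s , t , ℒsqt , x≤s , x≤t) (tri> _ _ b<x)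
      with b<zrun⇒false (<-≤-trans b<x x≤s) | b<zrun⇒false (<-≤-trans b<x x≤t) | x ≟ a
    ... | refl | refl | yes refl =
      one true ¬orbit ¬orbit (from (ℒ-wrap1-T′ a q) (false , refl , ℒsqt))
        (λ ℒw₀ → let (s′ , _ , _ , a<s′ , _) = to (ℒ-wrap0-T′ a q) ℒw₀ in <⇒≱ a<s′ (zrun≤a s′))
    ... | refl | refl | no x≢a =
      one false ¬orbit ¬orbit (from (ℒ-wrap0-T′ x q) (false , false , ℒsqt , x<a , x<a))
        (no-isolated-run λ { false → x≢a ; true → x≢b })
      where
      x<a : x < a
      x<a = ≤∧≢⇒< x≤s x≢a

  length-φ : ∀ q → length q ≤ length (Φ q)
  length-φ []      = z≤n
  length-φ (s ∷ q) = begin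
    suc (length q)                               ≤⟨ s≤s (length-φ q) ⟩
    suc (length (Φ q))                           ≤⟨ m≤n+m _ (zrun s) ⟩
    zrun s + length (true ∷ Φ q)                 ≡⟨ cong (_+ _) (sym (length-replicate (zrun s))) ⟩
    length (zeros (zrun s)) + length (true ∷ Φ q) ≡⟨ sym (length-++ (zeros (zrun s))) ⟩
    length (zeros (zrun s) ++ true ∷ Φ q)        ≡⟨ cong length (sym (φ-∷ s q)) ⟩
    length (Φ (s ∷ q))                           ∎
    where open ≤-Reasoning

  length-T′ : ∀ x q y → length q < length (T′ x q y)
  length-T′ x q y = begin-strict
    length q                              ≤⟨ length-φ q ⟩
    length (Φ q)                          ≤⟨ m≤m+n _ _ ⟩
    length (Φ q) + length (zeros y)       ≡⟨ sym (length-++ (Φ q)) ⟩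
    length (Φ q ++ zeros y)               <⟨ n<1+n _ ⟩
    length (true ∷ Φ q ++ zeros y)        ≤⟨ m≤n+m _ _ ⟩
    length (zeros x) + length (true ∷ Φ q ++ zeros y) ≡⟨ sym (length-++ (zeros x)) ⟩
    length (T′ x q y)                     ∎
    where open ≤-Reasoning

  extensions : ∀ {w} → Palindrome w → ℒ w → Extensions w
  extensions {w} = bounded (suc (length w)) ≤-refl
    where
    bounded : ∀ N {w} → length w < N → Palindrome w → ℒ w → Extensions w
    bounded (suc N) {w} |w|≤N pal ℒw = by-shape (ℒ-shape w ℒw)
      where
      by-shape : (∃ λ k → w ≡ zeros k) ⊎ (∃₂ λ x q → ∃ λ y → w ≡ T′ x q y) → Extensions w
      by-shape (inj₁ (k , refl)) = extensions-zeros k (ℒ-zeros⇒≤a k ℒw)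
      by-shape (inj₂ (x , q , y , refl)) with T′-palindrome⇒ x q y pal
      ... | refl , palq with x ≟ b
      ...   | no x≢b  = extensions-T′ x q ℒw x≢b
      ...   | yes refl = extensions-T (bounded N (<-≤-trans (length-T′ b q b) (≤-pred |w|≤N)) palq (ℒ-T′-inner ℒw))

  ∣φ∣₀ : ∀ w → ∣ Φ w ∣₀ ≡ a * ∣ w ∣₀ + b * ∣ w ∣₁
  ∣φ∣₀ []      = cong₂ _+_ (sym (*-zeroʳ a)) (sym (*-zeroʳ b))
  ∣φ∣₀ (s ∷ w) = begin
    ∣ Φ (s ∷ w) ∣₀                              ≡⟨ cong ∣_∣₀ (φ-∷ s w) ⟩
    ∣ zeros (zrun s) ++ true ∷ Φ w ∣₀           ≡⟨ ∣++∣₀ (zeros (zrun s)) _ ⟩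
    ∣ zeros (zrun s) ∣₀ + ∣ Φ w ∣₀              ≡⟨ cong₂ _+_ (∣zeros∣₀ (zrun s)) (∣φ∣₀ w) ⟩
    zrun s + (a * ∣ w ∣₀ + b * ∣ w ∣₁)          ≡⟨ letter s ⟩
    a * ∣ s ∷ w ∣₀ + b * ∣ s ∷ w ∣₁             ∎
    where
    open ≡-Reasoning
    letter : ∀ s → zrun s + (a * ∣ w ∣₀ + b * ∣ w ∣₁) ≡ a * ∣ s ∷ w ∣₀ + b * ∣ s ∷ w ∣₁
    letter false = trans (sym (+-assoc a _ _)) (cong (_+ b * ∣ w ∣₁) (sym (*-suc a ∣ w ∣₀)))
    letter true  = trans (x∙yz≈y∙xz b (a * ∣ w ∣₀) (b * ∣ w ∣₁)) (cong (a * ∣ w ∣₀ +_) (sym (*-suc b ∣ w ∣₁)))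

  ∣φ∣₁ : ∀ w → ∣ Φ w ∣₁ ≡ length w
  ∣φ∣₁ []      = refl
  ∣φ∣₁ (s ∷ w) = begin
    ∣ Φ (s ∷ w) ∣₁                     ≡⟨ cong ∣_∣₁ (φ-∷ s w) ⟩
    ∣ zeros (zrun s) ++ true ∷ Φ w ∣₁  ≡⟨ ∣++∣₁ (zeros (zrun s)) _ ⟩
    ∣ zeros (zrun s) ∣₁ + suc ∣ Φ w ∣₁ ≡⟨ cong₂ _+_ (∣zeros∣₁ (zrun s)) (cong suc (∣φ∣₁ w)) ⟩
    suc (length w)                     ∎
    where open ≡-Reasoning

  ∣T∣₀ : ∀ q → ∣ T′ b q b ∣₀ ≡ b + ((a * ∣ q ∣₀ + b * ∣ q ∣₁) + b)
  ∣T∣₀ q = begin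
    ∣ zeros b ++ true ∷ Φ q ++ zeros b ∣₀        ≡⟨ ∣++∣₀ (zeros b) _ ⟩
    ∣ zeros b ∣₀ + ∣ Φ q ++ zeros b ∣₀           ≡⟨ cong₂ _+_ (∣zeros∣₀ b) (∣++∣₀ (Φ q) (zeros b)) ⟩
    b + (∣ Φ q ∣₀ + ∣ zeros b ∣₀)                ≡⟨ cong (b +_) (cong₂ _+_ (∣φ∣₀ q) (∣zeros∣₀ b)) ⟩
    b + ((a * ∣ q ∣₀ + b * ∣ q ∣₁) + b)          ∎
    where open ≡-Reasoning

  ∣T∣₁ : ∀ q → ∣ T′ b q b ∣₁ ≡ suc (∣ q ∣₀ + ∣ q ∣₁)
  ∣T∣₁ q = begin
    ∣ zeros b ++ true ∷ Φ q ++ zeros b ∣₁        ≡⟨ ∣++∣₁ (zeros b) _ ⟩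
    ∣ zeros b ∣₁ + suc ∣ Φ q ++ zeros b ∣₁       ≡⟨ cong₂ _+_ (∣zeros∣₁ b) (cong suc (∣++∣₁ (Φ q) (zeros b))) ⟩
    suc (∣ Φ q ∣₁ + ∣ zeros b ∣₁)                ≡⟨ cong suc (cong₂ _+_ (∣φ∣₁ q) (∣zeros∣₁ b)) ⟩
    suc (length q + 0)                           ≡⟨ cong suc (trans (+-identityʳ _) (length≡∣∣₀+∣∣₁ q)) ⟩
    suc (∣ q ∣₀ + ∣ q ∣₁)                        ∎
    where open ≡-Reasoning

  -- T is monotone for this order, though not for length alone.
  record _≺_ (w w′ : Word) : Set where
    constructor _,_
    field
      zeros< : ∣ w ∣₀ < ∣ w′ ∣₀
      ones≤  : ∣ w ∣₁ ≤ ∣ w′ ∣₁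

  ≺⇒length< : ∀ {w w′} → w ≺ w′ → length w < length w′
  ≺⇒length< {w} {w′} (<₀ , ≤₁) =
    subst₂ _<_ (sym (length≡∣∣₀+∣∣₁ w)) (sym (length≡∣∣₀+∣∣₁ w′)) (+-mono-<-≤ <₀ ≤₁)

  T-mono-≺ : ∀ {q q′} → q ≺ q′ → T′ b q b ≺ T′ b q′ b
  T-mono-≺ {q} {q′} (<₀ , ≤₁) =
    subst₂ _<_ (sym (∣T∣₀ q)) (sym (∣T∣₀ q′))
      (+-monoʳ-< b (+-monoˡ-< b (+-mono-<-≤ (*-monoʳ-< a {{>-nonZero 1≤a}} <₀) (*-monoʳ-≤ b ≤₁)))) ,
    subst₂ _≤_ (sym (∣T∣₁ q)) (sym (∣T∣₁ q′)) (s≤s (+-mono-≤ (<⇒≤ <₀) ≤₁))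

  V≺U : ∀ n → T-orbit b n ≺ T-orbit (a ∸ 1) n
  V≺U zero    = subst₂ _<_ (sym (∣zeros∣₀ b)) (sym (∣zeros∣₀ (a ∸ 1))) b<a∸1 ,
                subst₂ _≤_ (sym (∣zeros∣₁ b)) (sym (∣zeros∣₁ (a ∸ 1))) z≤n
  V≺U (suc n) = T-mono-≺ (V≺U n)

  U≺V : ∀ n → T-orbit (a ∸ 1) n ≺ T-orbit b (suc n)
  U≺V zero    = subst₂ _<_ (sym (∣zeros∣₀ (a ∸ 1))) (sym (∣T∣₀ (zeros b))) a∸1<∣T0ᵇ∣₀ ,
                subst (_≤ ∣ T′ b (zeros b) b ∣₁) (sym (∣zeros∣₁ (a ∸ 1))) z≤n
    where
    a∸1<∣T0ᵇ∣₀ : a ∸ 1 < b + ((a * ∣ zeros b ∣₀ + b * ∣ zeros b ∣₁) + b)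
    a∸1<∣T0ᵇ∣₀ = begin-strict
      a ∸ 1                                         <⟨ a∸1<a ⟩
      a                                             ≤⟨ m≤m*n a b {{>-nonZero 1≤b}} ⟩
      a * b                                         ≡⟨ cong (a *_) (sym (∣zeros∣₀ b)) ⟩
      a * ∣ zeros b ∣₀                              ≤⟨ m≤m+n _ _ ⟩
      a * ∣ zeros b ∣₀ + b * ∣ zeros b ∣₁           ≤⟨ m≤m+n _ _ ⟩
      (a * ∣ zeros b ∣₀ + b * ∣ zeros b ∣₁) + b     ≤⟨ m≤n+m _ b ⟩
      b + ((a * ∣ zeros b ∣₀ + b * ∣ zeros b ∣₁) + b) ∎
      where open ≤-Reasoning
  U≺V (suc n) = T-mono-≺ (U≺V n)

  ∣V∣≡length-T-orbit : ∀ n → ∣V∣ a b (suc n) ≡ length (T-orbit b n)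
  ∣V∣≡length-T-orbit n = cong length (V≡T-orbit n)

  ∣U∣≡length-T-orbit : ∀ n → ∣U∣ a b (suc n) ≡ length (T-orbit (a ∸ 1) n)
  ∣U∣≡length-T-orbit n = cong length (U≡T-orbit n)

  ∣V∣<∣U∣-same : ∀ n → ∣V∣ a b (suc n) < ∣U∣ a b (suc n)
  ∣V∣<∣U∣-same n = subst₂ _<_ (sym (∣V∣≡length-T-orbit n)) (sym (∣U∣≡length-T-orbit n)) (≺⇒length< (V≺U n))

  ∣U∣<∣V∣-next : ∀ n → ∣U∣ a b n < ∣V∣ a b (suc n)
  ∣U∣<∣V∣-next zero    = subst (0 <_) (sym (length-replicate b)) 1≤b
  ∣U∣<∣V∣-next (suc n) =
    subst₂ _<_ (sym (∣U∣≡length-T-orbit n)) (sym (∣V∣≡length-T-orbit (suc n))) (≺⇒length< (U≺V n))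

  ∣V∣-increasing : ∀ n → ∣V∣ a b n < ∣V∣ a b (suc n)
  ∣V∣-increasing zero    = ∣U∣<∣V∣-next zero
  ∣V∣-increasing (suc n) = <-trans (∣V∣<∣U∣-same n) (∣U∣<∣V∣-next (suc n))

  ∣U∣-increasing : ∀ n → ∣U∣ a b n < ∣U∣ a b (suc n)
  ∣U∣-increasing n = <-trans (∣U∣<∣V∣-next n) (∣V∣<∣U∣-same n)

  module V-lengths = StrictlyIncreasing (∣V∣ a b) ∣V∣-increasing
  module U-lengths = StrictlyIncreasing (∣U∣ a b) ∣U∣-increasing

  ∣V∣<∣U∣ : ∀ {m n} → m ≤ n → 1 ≤ n → ∣V∣ a b m < ∣U∣ a b n
  ∣V∣<∣U∣ {n = suc n} m≤1+n _ = ≤-<-trans (V-lengths.mono-≤ m≤1+n) (∣V∣<∣U∣-same n)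

  ∣U∣<∣V∣ : ∀ {m n} → m < n → ∣U∣ a b m < ∣V∣ a b n
  ∣U∣<∣V∣ {m} m<n = <-≤-trans (∣U∣<∣V∣-next m) (V-lengths.mono-≤ m<n)

  ∣V∣≢∣U∣ : ∀ m n → ∣V∣ a b (suc m) ≢ ∣U∣ a b n
  ∣V∣≢∣U∣ m zero    e = <⇒≢ (∣U∣<∣V∣ {0} {suc m} (s≤s z≤n)) (sym e)
  ∣V∣≢∣U∣ m (suc n) e with ≤-<-connex m n
  ... | inj₁ m≤n = <⇒≢ (∣V∣<∣U∣ {suc m} {suc n} (s≤s m≤n) (s≤s z≤n)) e
  ... | inj₂ n<m = <⇒≢ (∣U∣<∣V∣ {suc n} {suc m} (s≤s n<m)) (sym e)

  parities : Word → Bool × Bool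
  parities w = parity ∣ w ∣₀ , parity ∣ w ∣₁

  parity-length : ∀ w → parity (length w) ≡ total (parities w)
  parity-length w = trans (cong parity (length≡∣∣₀+∣∣₁ w)) (parity-+ ∣ w ∣₀ ∣ w ∣₁)

  parities-T : ∀ q → parities (T′ b q b) ≡ T-step (parity a) (parity b) (parities q)
  parities-T q = cong₂ _,_ zeros-parity (trans (cong parity (∣T∣₁ q)) (cong not (parity-+ ∣ q ∣₀ ∣ q ∣₁)))
    where
    open ≡-Reasoning
    pb : Bool
    pb = parity b
    N : ℕ
    N = a * ∣ q ∣₀ + b * ∣ q ∣₁
    zeros-parity : parity ∣ T′ b q b ∣₀ ≡ (parity a ∧ parity ∣ q ∣₀) xor (pb ∧ parity ∣ q ∣₁)
    zeros-parity = begin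
      parity ∣ T′ b q b ∣₀        ≡⟨ cong parity (∣T∣₀ q) ⟩
      parity (b + (N + b))       ≡⟨ trans (parity-+ b (N + b)) (cong (pb xor_) (parity-+ N b)) ⟩
      pb xor (parity N xor pb)   ≡⟨ cong (pb xor_) (xor-comm (parity N) pb) ⟩
      pb xor (pb xor parity N)   ≡⟨ sym (xor-assoc pb pb (parity N)) ⟩
      (pb xor pb) xor parity N   ≡⟨ cong (_xor parity N) (xor-same pb) ⟩
      parity N                   ≡⟨ trans (parity-+ (a * ∣ q ∣₀) _) (cong₂ _xor_ (parity-* a _) (parity-* b _)) ⟩
      (parity a ∧ parity ∣ q ∣₀) xor (pb ∧ parity ∣ q ∣₁) ∎

  parities-T-orbit : ∀ k n → parities (T-orbit k n) ≡ fold (parity k , false) (T-step (parity a) (parity b)) n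
  parities-T-orbit k zero    = cong₂ _,_ (cong parity (∣zeros∣₀ k)) (cong parity (∣zeros∣₁ k))
  parities-T-orbit k (suc n) = trans (parities-T (T-orbit k n)) (cong (T-step (parity a) (parity b)) (parities-T-orbit k n))

  parity-∣V∣ : ∀ n → parity (∣V∣ a b (suc n)) ≡ total (fold (parity b , false) (T-step (parity a) (parity b)) n)
  parity-∣V∣ n = begin
    parity (∣V∣ a b (suc n))                 ≡⟨ cong parity (∣V∣≡length-T-orbit n) ⟩
    parity (length (T-orbit b n))            ≡⟨ parity-length (T-orbit b n) ⟩
    total (parities (T-orbit b n))           ≡⟨ cong total (parities-T-orbit b n) ⟩
    total (fold (parity b , false) step n)   ∎
    where
    open ≡-Reasoning
    step : Bool × Bool → Bool × Bool
    step = T-step (parity a) (parity b)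

  parity-∣U∣ : ∀ n → parity (∣U∣ a b (suc n)) ≡ total (fold (not (parity a) , false) (T-step (parity a) (parity b)) n)
  parity-∣U∣ n = begin
    parity (∣U∣ a b (suc n))                       ≡⟨ cong parity (∣U∣≡length-T-orbit n) ⟩
    parity (length (T-orbit (a ∸ 1) n))            ≡⟨ parity-length (T-orbit (a ∸ 1) n) ⟩
    total (parities (T-orbit (a ∸ 1) n))           ≡⟨ cong total (parities-T-orbit (a ∸ 1) n) ⟩
    total (fold (parity (a ∸ 1) , false) step n)   ≡⟨ cong (λ p → total (fold (p , false) step n)) parity-a∸1 ⟩
    total (fold (not (parity a) , false) step n)   ∎
    where
    open ≡-Reasoning
    step : Bool × Bool → Bool × Bool
    step = T-step (parity a) (parity b)
    parity-a∸1 : parity (a ∸ 1) ≡ not (parity a)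
    parity-a∸1 = trans (sym (not-involutive _)) (cong (not ∘′ parity) (sym a≡1+a∸1))

  PalFactor : Word → Set
  PalFactor w = Palindrome w × ℒ w

  extension-list : ∀ {w} → Extensions w → List Word
  extension-list {w} (both _ _ _)    = wrap false w ∷ wrap true w ∷ []
  extension-list     (none _ _ _)    = []
  extension-list {w} (one s _ _ _ _) = wrap s w ∷ []

  [V] [U] : ∀ {w} → Extensions w → ℕ
  [V] (both _ _ _)    = 1
  [V] (none _ _ _)    = 0
  [V] (one _ _ _ _ _) = 0
  [U] (both _ _ _)    = 0
  [U] (none _ _ _)    = 1
  [U] (one _ _ _ _ _) = 0

  length-extension-list : ∀ {w} (e : Extensions w) → length (extension-list e) + [U] e ≡ 1 + [V] e
  length-extension-list (both _ _ _)    = refl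
  length-extension-list (none _ _ _)    = refl
  length-extension-list (one _ _ _ _ _) = refl

  extension-list-unique : ∀ {w} (e : Extensions w) → Unique (extension-list e)
  extension-list-unique (both _ _ _)    = ((λ ()) ∷ []) ∷ [] ∷ []
  extension-list-unique (none _ _ _)    = []
  extension-list-unique (one _ _ _ _ _) = [] ∷ []

  ∈-extension-list⁻ : ∀ {w v} (e : Extensions w) → v ∈ extension-list e → ∃ λ s → v ≡ wrap s w × ℒ v
  ∈-extension-list⁻ (both _ ℒ0 _)    (here refl)         = false , refl , ℒ0
  ∈-extension-list⁻ (both _ _ ℒ1)    (there (here refl)) = true , refl , ℒ1
  ∈-extension-list⁻ (one s _ _ ℒs _) (here refl)         = s , refl , ℒs

  ∈-extension-list⁺ : ∀ {w} (e : Extensions w) s → ℒ (wrap s w) → wrap s w ∈ extension-list e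
  ∈-extension-list⁺ (both _ _ _)          false _  = here refl
  ∈-extension-list⁺ (both _ _ _)          true  _  = there (here refl)
  ∈-extension-list⁺ (none _ ¬ℒ0 _)        false ℒ0 = ⊥-elim (¬ℒ0 ℒ0)
  ∈-extension-list⁺ (none _ _ ¬ℒ1)        true  ℒ1 = ⊥-elim (¬ℒ1 ℒ1)
  ∈-extension-list⁺ (one false _ _ _ _)   false _  = here refl
  ∈-extension-list⁺ (one false _ _ _ ¬ℒ1) true  ℒ1 = ⊥-elim (¬ℒ1 ℒ1)
  ∈-extension-list⁺ (one true _ _ _ ¬ℒ0)  false ℒ0 = ⊥-elim (¬ℒ0 ℒ0)
  ∈-extension-list⁺ (one true _ _ _ _)    true  _  = here refl

  extensions-of : ∀ {w} → PalFactor w → Extensions w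
  extensions-of (pal , ℒw) = extensions pal ℒw

  all-extensions : ∀ {L} → All PalFactor L → List Word
  all-extensions []       = []
  all-extensions (p ∷ ps) = extension-list (extensions-of p) ++ all-extensions ps

  ∈-all-extensions⁻ : ∀ {L v} (ps : All PalFactor L) → v ∈ all-extensions ps →
                      ∃₂ λ s w → w ∈ L × v ≡ wrap s w × ℒ v
  ∈-all-extensions⁻ (p ∷ ps) v∈ with ∈-++⁻ (extension-list (extensions-of p)) v∈
  ... | inj₁ v∈₁ = let (s , v≡ , ℒv) = ∈-extension-list⁻ (extensions-of p) v∈₁ in s , _ , here refl , v≡ , ℒv
  ... | inj₂ v∈₂ = let (s , w , w∈ , v≡ , ℒv) = ∈-all-extensions⁻ ps v∈₂ in s , w , there w∈ , v≡ , ℒv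

  ∈-all-extensions⁺ : ∀ {L w} (ps : All PalFactor L) s → w ∈ L → ℒ (wrap s w) → wrap s w ∈ all-extensions ps
  ∈-all-extensions⁺ (p ∷ ps) s (here refl) ℒw = ∈-++⁺ˡ (∈-extension-list⁺ (extensions-of p) s ℒw)
  ∈-all-extensions⁺ (p ∷ ps) s (there w∈) ℒw =
    ∈-++⁺ʳ (extension-list (extensions-of p)) (∈-all-extensions⁺ ps s w∈ ℒw)

  all-extensions-unique : ∀ {L} (ps : All PalFactor L) → Unique L → Unique (all-extensions ps)
  all-extensions-unique []       _         = []
  all-extensions-unique (p ∷ ps) (w∉ ∷ u) =
    ++⁺ (extension-list-unique (extensions-of p)) (all-extensions-unique ps u) disjoint
    where
    disjoint : ∀ {v} → ¬ (v ∈ extension-list (extensions-of p) × v ∈ all-extensions ps)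
    disjoint (v∈₁ , v∈₂) with ∈-extension-list⁻ (extensions-of p) v∈₁ | ∈-all-extensions⁻ ps v∈₂
    ... | _ , refl , _ | _ , w′ , w′∈ , v≡ , _ = All.lookup w∉ w′∈ (proj₂ (wrap-injective v≡))

  length-all-extensions : ∀ {L} (ps : All PalFactor L) →
    length (all-extensions ps) + ∑ ([U] ∘ extensions-of) ps ≡ length L + ∑ ([V] ∘ extensions-of) ps
  length-all-extensions []       = refl
  length-all-extensions {w ∷ L} (p ∷ ps) = begin
    length (E ++ E′) + ([U] e + ∑U)          ≡⟨ cong (_+ ([U] e + ∑U)) (length-++ E) ⟩
    (length E + length E′) + ([U] e + ∑U)     ≡⟨ interchange (length E) (length E′) ([U] e) ∑U ⟩
    (length E + [U] e) + (length E′ + ∑U)     ≡⟨ cong₂ _+_ (length-extension-list e) (length-all-extensions ps) ⟩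
    (1 + [V] e) + (length L + ∑V)             ≡⟨ cong suc (x∙yz≈y∙xz ([V] e) (length L) ∑V) ⟩
    suc (length L + ([V] e + ∑V))             ∎
    where
    open ≡-Reasoning
    e : Extensions w
    e = extensions-of p
    E E′ : List Word
    E = extension-list e
    E′ = all-extensions ps
    ∑U ∑V : ℕ
    ∑U = ∑ ([U] ∘ extensions-of) ps
    ∑V = ∑ ([V] ∘ extensions-of) ps

  orbits-disjoint : ∀ {w} → InOrbit b w → ¬ InOrbit (a ∸ 1) w
  orbits-disjoint (n , refl) (n′ , e) =
    ∣V∣≢∣U∣ n (suc n′) (trans (∣V∣≡length-T-orbit n) (trans (cong length e) (sym (∣U∣≡length-T-orbit n′))))

  [V]-orbit : ∀ {w} (e : Extensions w) → InOrbit b w → [V] e ≡ 1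
  [V]-orbit (both _ _ _)     _  = refl
  [V]-orbit (none o _ _)     o′ = ⊥-elim (orbits-disjoint o′ o)
  [V]-orbit (one _ ¬o _ _ _) o  = ⊥-elim (¬o o)

  [V]-¬orbit : ∀ {w} (e : Extensions w) → ¬ InOrbit b w → [V] e ≡ 0
  [V]-¬orbit (both o _ _)    ¬o = ⊥-elim (¬o o)
  [V]-¬orbit (none _ _ _)    _  = refl
  [V]-¬orbit (one _ _ _ _ _) _  = refl

  [U]-orbit : ∀ {w} (e : Extensions w) → InOrbit (a ∸ 1) w → [U] e ≡ 1
  [U]-orbit (both o _ _)     o′ = ⊥-elim (orbits-disjoint o o′)
  [U]-orbit (none _ _ _)     _  = refl
  [U]-orbit (one _ _ ¬o _ _) o  = ⊥-elim (¬o o)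

  [U]-¬orbit : ∀ {w} (e : Extensions w) → ¬ InOrbit (a ∸ 1) w → [U] e ≡ 0
  [U]-¬orbit (both _ _ _)    _  = refl
  [U]-¬orbit (none o _ _)    ¬o = ⊥-elim (¬o o)
  [U]-¬orbit (one _ _ _ _ _) _  = refl

  InOrbit-of-V-length : ∀ {w} n → InOrbit b w → length w ≡ ∣V∣ a b (suc n) → w ≡ T-orbit b n
  InOrbit-of-V-length n (n′ , refl) |w|≡ =
    cong (T-orbit b) (suc-injective (V-lengths.injective {suc n′} {suc n} (trans (∣V∣≡length-T-orbit n′) |w|≡)))

  InOrbit-of-U-length : ∀ {w} n → InOrbit (a ∸ 1) w → length w ≡ ∣U∣ a b (suc n) → w ≡ T-orbit (a ∸ 1) n
  InOrbit-of-U-length n (n′ , refl) |w|≡ =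
    cong (T-orbit (a ∸ 1)) (suc-injective (U-lengths.injective {suc n′} {suc n} (trans (∣U∣≡length-T-orbit n′) |w|≡)))

  IsVLength IsULength : ℕ → Set
  IsVLength m = ∃ λ n → ∣V∣ a b (suc n) ≡ m
  IsULength m = ∃ λ n → ∣U∣ a b (suc n) ≡ m

  InOrbit-b⇒IsVLength : ∀ {w} → InOrbit b w → IsVLength (length w)
  InOrbit-b⇒IsVLength (n , refl) = n , ∣V∣≡length-T-orbit n

  InOrbit-a∸1⇒IsULength : ∀ {w} → InOrbit (a ∸ 1) w → IsULength (length w)
  InOrbit-a∸1⇒IsULength (n , refl) = n , ∣U∣≡length-T-orbit n

  Enumerates : ℕ → List Word → Set
  Enumerates m L = ∀ w → (w ∈ L → length w ≡ m × Palindrome w × Factor (uβ a b) w)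
                       × (length w ≡ m × Palindrome w × Factor (uβ a b) w → w ∈ L)

  pal-factors : ∀ {m L} → Enumerates m L → All PalFactor L
  pal-factors enum = All.tabulate λ {w} w∈ → let (_ , pal , F) = proj₁ (enum w) w∈ in pal , Factor⇒ℒ F

  all-extensions-enumerate : ∀ {m L} (enum : Enumerates m L) → Enumerates (2 + m) (all-extensions (pal-factors enum))
  all-extensions-enumerate {m} enum v = listed , complete
    where
    listed : v ∈ all-extensions (pal-factors enum) → length v ≡ 2 + m × Palindrome v × Factor (uβ a b) v
    listed v∈ with ∈-all-extensions⁻ (pal-factors enum) v∈
    ... | s , w , w∈ , refl , ℒv = let (|w| , pal , _) = proj₁ (enum w) w∈ in
      trans (length-wrap s w) (cong (2 +_) |w|) , wrap-palindrome s pal , ℒ⇒Factor ℒv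
    complete : length v ≡ 2 + m × Palindrome v × Factor (uβ a b) v → v ∈ all-extensions (pal-factors enum)
    complete (|v| , pal , F) with palindrome-unwrap m v pal |v|
    ... | s , w , refl , palw , |w| =
      ∈-all-extensions⁺ (pal-factors enum) s (proj₂ (enum w) (|w| , palw , ℒ⇒Factor (ℒ-⊑ (⊑-wrap s s) ℒv))) ℒv
      where
      ℒv : ℒ (wrap s w)
      ℒv = Factor⇒ℒ F

  palCount-+2 : ∀ {m L} → Unique L → (enum : Enumerates m L) → ∀ c →
                c + ∑ ([U] ∘ extensions-of) (pal-factors enum) ≡ length L + ∑ ([V] ∘ extensions-of) (pal-factors enum) →
                PalCount a b (2 + m) c
  palCount-+2 {L = L} u enum c balance =
    all-extensions ps , all-extensions-unique ps u ,
    +-cancelʳ-≡ _ _ _ (trans (length-all-extensions ps) (sym balance)) ,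
    all-extensions-enumerate enum
    where
    ps : All PalFactor L
    ps = pal-factors enum

  module _ {m L} (enum : Enumerates m L) where
    private
      ps : All PalFactor L
      ps = pal-factors enum

      length-∈ : ∀ {w} → w ∈ L → length w ≡ m
      length-∈ {w} w∈ = proj₁ (proj₁ (enum w) w∈)

    ∑V≡1 : Unique L → (n : ℕ) → ∣V∣ a b (suc n) ≡ m → ∑ ([V] ∘ extensions-of) ps ≡ 1
    ∑V≡1 u n |V|≡m = ∑-single _ ps u V∈L (λ p → [V]-orbit (extensions-of p) (n , refl)) other
      where
      V∈L : T-orbit b n ∈ L
      V∈L = proj₂ (enum _) (trans (sym (∣V∣≡length-T-orbit n)) |V|≡m , T-orbit-palindrome b n ,
                            ℒ⇒Factor (ℒ-T-orbit n (<⇒≤ b<a)))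
      other : ∀ {w} (p : PalFactor w) → w ∈ L → w ≢ T-orbit b n → [V] (extensions-of p) ≡ 0
      other p w∈ w≢ = [V]-¬orbit (extensions-of p) λ o → w≢ (InOrbit-of-V-length n o (trans (length-∈ w∈) (sym |V|≡m)))

    ∑U≡1 : Unique L → (n : ℕ) → ∣U∣ a b (suc n) ≡ m → ∑ ([U] ∘ extensions-of) ps ≡ 1
    ∑U≡1 u n |U|≡m = ∑-single _ ps u U∈L (λ p → [U]-orbit (extensions-of p) (n , refl)) other
      where
      U∈L : T-orbit (a ∸ 1) n ∈ L
      U∈L = proj₂ (enum _) (trans (sym (∣U∣≡length-T-orbit n)) |U|≡m , T-orbit-palindrome (a ∸ 1) n ,
                            ℒ⇒Factor (ℒ-T-orbit n (m∸n≤m a 1)))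
      other : ∀ {w} (p : PalFactor w) → w ∈ L → w ≢ T-orbit (a ∸ 1) n → [U] (extensions-of p) ≡ 0
      other p w∈ w≢ = [U]-¬orbit (extensions-of p) λ o → w≢ (InOrbit-of-U-length n o (trans (length-∈ w∈) (sym |U|≡m)))

    ∑V≡0 : ¬ IsVLength m → ∑ ([V] ∘ extensions-of) ps ≡ 0
    ∑V≡0 ¬V = ∑-zero _ ps λ p w∈ → [V]-¬orbit (extensions-of p) λ o →
      ¬V (subst IsVLength (length-∈ w∈) (InOrbit-b⇒IsVLength o))

    ∑U≡0 : ¬ IsULength m → ∑ ([U] ∘ extensions-of) ps ≡ 0
    ∑U≡0 ¬U = ∑-zero _ ps λ p w∈ → [U]-¬orbit (extensions-of p) λ o →
      ¬U (subst IsULength (length-∈ w∈) (InOrbit-a∸1⇒IsULength o))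

  palCount-V : ∀ {m c} → PalCount a b m c → IsVLength m → PalCount a b (2 + m) (suc c)
  palCount-V {m} (L , u , refl , enum) (n , |V|≡m) = palCount-+2 u enum _ (begin
    suc (length L) + ∑ ([U] ∘ extensions-of) (pal-factors enum) ≡⟨ cong (suc (length L) +_) (∑U≡0 enum ¬U) ⟩
    suc (length L) + 0                                         ≡⟨ trans (+-identityʳ _) (+-comm 1 _) ⟩
    length L + 1                                               ≡⟨ cong (length L +_) (sym (∑V≡1 enum u n |V|≡m)) ⟩
    length L + ∑ ([V] ∘ extensions-of) (pal-factors enum)      ∎)
    where
    open ≡-Reasoning
    ¬U : ¬ IsULength m
    ¬U (n′ , |U|≡m) = ∣V∣≢∣U∣ n (suc n′) (trans |V|≡m (sym |U|≡m))

  palCount-U : ∀ {m c} → PalCount a b m (suc c) → IsULength m → PalCount a b (2 + m) c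
  palCount-U {m} {c} (L , u , |L| , enum) (n , |U|≡m) = palCount-+2 u enum c (begin
    c + ∑ ([U] ∘ extensions-of) (pal-factors enum)         ≡⟨ cong (c +_) (∑U≡1 enum u n |U|≡m) ⟩
    c + 1                                                  ≡⟨ +-comm c 1 ⟩
    suc c                                                  ≡⟨ sym |L| ⟩
    length L                                               ≡⟨ sym (+-identityʳ _) ⟩
    length L + 0                                           ≡⟨ cong (length L +_) (sym (∑V≡0 enum ¬V)) ⟩
    length L + ∑ ([V] ∘ extensions-of) (pal-factors enum)  ∎)
    where
    open ≡-Reasoning
    ¬V : ¬ IsVLength m
    ¬V (n′ , |V|≡m) = ∣V∣≢∣U∣ n′ (suc n) (trans |V|≡m (sym |U|≡m))

  palCount-flat : ∀ {m c} → PalCount a b m c → ¬ IsVLength m → ¬ IsULength m → PalCount a b (2 + m) c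
  palCount-flat (L , u , refl , enum) ¬V ¬U =
    palCount-+2 u enum _ (trans (cong (length L +_) (∑U≡0 enum ¬U)) (sym (cong (length L +_) (∑V≡0 enum ¬V))))

  palCount-0 : PalCount a b 0 1
  palCount-0 = [ [] ] , [] ∷ [] , refl , λ w → listed w , complete w
    where
    listed : ∀ w → w ∈ [ [] ] → length w ≡ 0 × Palindrome w × Factor (uβ a b) w
    listed _ (here refl) = refl , refl , ℒ⇒Factor ℒ-[]
    complete : ∀ w → length w ≡ 0 × Palindrome w × Factor (uβ a b) w → w ∈ [ [] ]
    complete [] _ = here refl

  palCount-1 : PalCount a b 1 2
  palCount-1 = [ false ] ∷ [ true ] ∷ [] , ((λ ()) ∷ []) ∷ [] ∷ [] , refl , λ w → listed w , complete w
    where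
    listed : ∀ w → w ∈ [ false ] ∷ [ true ] ∷ [] → length w ≡ 1 × Palindrome w × Factor (uβ a b) w
    listed _ (here refl)         = refl , refl , ℒ⇒Factor (ℒ-letter false)
    listed _ (there (here refl)) = refl , refl , ℒ⇒Factor (ℒ-letter true)
    complete : ∀ w → length w ≡ 1 × Palindrome w × Factor (uβ a b) w → w ∈ [ false ] ∷ [ true ] ∷ []
    complete (false ∷ []) _ = here refl
    complete (true  ∷ []) _ = there (here refl)

  IsVLength-at : ∀ {i m} → 1 ≤ i → ∣V∣ a b i ≡ m → IsVLength m
  IsVLength-at {suc n} _ e = n , e

  IsULength-at : ∀ {i m} → 1 ≤ i → ∣U∣ a b i ≡ m → IsULength m
  IsULength-at {suc n} _ e = n , e

  2+[2*j+r] : ∀ j r → 2 + (2 * j + r) ≡ 2 * suc j + r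
  2+[2*j+r] j r = trans (sym (+-assoc 2 (2 * j) r)) (cong (_+ r) (sym (*-suc 2 j)))

  palCount-V-step : ∀ j r {c} → PalCount a b (2 * j + r) c → IsVLength (2 * j + r) → PalCount a b (2 * suc j + r) (suc c)
  palCount-V-step j r {c} P V = subst (λ m → PalCount a b m (suc c)) (2+[2*j+r] j r) (palCount-V P V)

  palCount-U-step : ∀ j r {c} → PalCount a b (2 * j + r) (suc c) → IsULength (2 * j + r) → PalCount a b (2 * suc j + r) c
  palCount-U-step j r {c} P U = subst (λ m → PalCount a b m c) (2+[2*j+r] j r) (palCount-U P U)

  palCount-flat-step : ∀ j r {c} → PalCount a b (2 * j + r) c → ¬ IsVLength (2 * j + r) → ¬ IsULength (2 * j + r) →
                       PalCount a b (2 * suc j + r) c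
  palCount-flat-step j r {c} P ¬V ¬U = subst (λ m → PalCount a b m c) (2+[2*j+r] j r) (palCount-flat P ¬V ¬U)

  palCount-flat-run : ∀ r c {j₀ J} → (∀ j → j₀ ≤ j → j < J → ¬ IsVLength (2 * j + r) × ¬ IsULength (2 * j + r)) →
                      PalCount a b (2 * j₀ + r) c → ∀ j → j₀ ≤ j → j ≤ J → PalCount a b (2 * j + r) c
  palCount-flat-run r c no-events =
    flat-run (λ j → PalCount a b (2 * j + r) c)
             (λ j j₀≤j j<J P → let (¬V , ¬U) = no-events j j₀≤j j<J in palCount-flat-step j r P ¬V ¬U)

  -- The V^(n) and U^(n) of length at least 2 j₀ + r and of the parity of r,
  -- enumerated as V^(gV k) and U^(gU k); their lengths alternate.
  record ParityClass (r j₀ : ℕ) : Set where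
    field
      gV gU    : ℕ → ℕ
      1≤gV     : ∀ k → 1 ≤ gV k
      gV≤gU    : ∀ k → gV k ≤ gU k
      gU<gV    : ∀ k → gU k < gV (suc k)
      parity-V : ∀ k → parity (∣V∣ a b (gV k)) ≡ parity r
      parity-U : ∀ k → parity (∣U∣ a b (gU k)) ≡ parity r
      only-V   : ∀ n → parity (∣V∣ a b (suc n)) ≡ parity r → 2 * j₀ + r ≤ ∣V∣ a b (suc n) → ∃ λ k → suc n ≡ gV k
      only-U   : ∀ n → parity (∣U∣ a b (suc n)) ≡ parity r → 2 * j₀ + r ≤ ∣U∣ a b (suc n) → ∃ λ k → suc n ≡ gU k

    Inside : ℕ → Set
    Inside m = ∃ λ k → ∣V∣ a b (gV k) < m × m ≤ ∣U∣ a b (gU k)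

  ¬Inside-≤b : ∀ {r j₀} (C : ParityClass r j₀) {m} → m ≤ b → ¬ ParityClass.Inside C m
  ¬Inside-≤b C m≤b (k , V<m , _) =
    <⇒≱ (<-≤-trans V<m m≤b) (subst (_≤ ∣V∣ a b (gV k)) (length-replicate b) (V-lengths.mono-≤ (1≤gV k)))
    where open ParityClass C

  module _ {r j₀} (r≤1 : r ≤ 1) (C : ParityClass r j₀) where
    open ParityClass C

    private
      P : ℕ → ℕ → Set
      P j c = PalCount a b (2 * j + r) c

      mono-< : ∀ {x y} → x < y → 2 * x + r < 2 * y + r
      mono-< x<y = +-monoˡ-< r (*-monoʳ-< 2 x<y)
      mono-≤ : ∀ {x y} → x ≤ y → 2 * x + r ≤ 2 * y + r
      mono-≤ x≤y = +-monoˡ-≤ r (*-monoʳ-≤ 2 x≤y)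
      cancel-< : ∀ {x y} → 2 * x + r < 2 * y + r → x < y
      cancel-< {x} {y} lt = *-cancelˡ-< 2 x y (+-cancelʳ-< r (2 * x) (2 * y) lt)
      cancel-≤ : ∀ {x y} → 2 * x + r ≤ 2 * y + r → x ≤ y
      cancel-≤ {x} {y} le = *-cancelˡ-≤ 2 (+-cancelʳ-≤ r (2 * x) (2 * y) le)
      cancel-≡ : ∀ {x y} → 2 * x + r ≡ 2 * y + r → x ≡ y
      cancel-≡ {x} {y} e = *-cancelˡ-≡ x y 2 (+-cancelʳ-≡ r (2 * x) (2 * y) e)

      v u : ℕ → ℕ
      v k = ⌊ ∣V∣ a b (gV k) /2⌋
      u k = ⌊ ∣U∣ a b (gU k) /2⌋

      2v+r : ∀ k → 2 * v k + r ≡ ∣V∣ a b (gV k)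
      2v+r k = 2*half+parity _ r≤1 (parity-V k)
      2u+r : ∀ k → 2 * u k + r ≡ ∣U∣ a b (gU k)
      2u+r k = 2*half+parity _ r≤1 (parity-U k)

      v<u : ∀ k → v k < u k
      v<u k = cancel-< (subst₂ _<_ (sym (2v+r k)) (sym (2u+r k)) (∣V∣<∣U∣ (gV≤gU k) (≤-trans (1≤gV k) (gV≤gU k))))
      u<v : ∀ k → u k < v (suc k)
      u<v k = cancel-< (subst₂ _<_ (sym (2u+r k)) (sym (2v+r (suc k))) (∣U∣<∣V∣ (gU<gV k)))

      up : ∀ j c → j₀ ≤ j → (∃ λ k → v k ≡ j) → P j c → P (suc j) (suc c)
      up j c _ (k , refl) Pj = palCount-V-step j r Pj (IsVLength-at (1≤gV k) (sym (2v+r k)))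

      down : ∀ j c → j₀ ≤ j → (∃ λ k → u k ≡ j) → P j (suc c) → P (suc j) c
      down j c _ (k , refl) Pj = palCount-U-step j r Pj (IsULength-at (≤-trans (1≤gV k) (gV≤gU k)) (sym (2u+r k)))

      flat : ∀ j c → j₀ ≤ j → ¬ (∃ λ k → v k ≡ j) → ¬ (∃ λ k → u k ≡ j) → P j c → P (suc j) c
      flat j c j₀≤j ¬v ¬u Pj = palCount-flat-step j r Pj ¬V ¬U
        where
        ¬V : ¬ IsVLength (2 * j + r)
        ¬V (n , e) with only-V n (trans (cong parity e) (parity-2*+ j r)) (subst (2 * j₀ + r ≤_) (sym e) (mono-≤ j₀≤j))
        ... | k , 1+n≡ = ¬v (k , cancel-≡ (trans (2v+r k) (trans (cong (∣V∣ a b) (sym 1+n≡)) e)))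
        ¬U : ¬ IsULength (2 * j + r)
        ¬U (n , e) with only-U n (trans (cong parity e) (parity-2*+ j r)) (subst (2 * j₀ + r ≤_) (sym e) (mono-≤ j₀≤j))
        ... | k , 1+n≡ = ¬u (k , cancel-≡ (trans (2u+r k) (trans (cong (∣U∣ a b) (sym 1+n≡)) e)))

      module Counter = Alternating P v u v<u u<v j₀ up down flat

      raised⇒inside : ∀ {j} → Counter.Raised j → Inside (2 * j + r)
      raised⇒inside (k , v<j , j≤u) = k , subst (_< _) (2v+r k) (mono-< v<j) , subst (_ ≤_) (2u+r k) (mono-≤ j≤u)

      inside⇒raised : ∀ {j} → Inside (2 * j + r) → Counter.Raised j
      inside⇒raised (k , V< , ≤U) = k , cancel-< (subst (_< _) (sym (2v+r k)) V<) , cancel-≤ (subst (_ ≤_) (sym (2u+r k)) ≤U)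

    palCount-class : ∀ c → PalCount a b (2 * j₀ + r) c → ¬ Inside (2 * j₀ + r) →
                     ∀ m → parity m ≡ parity r → 2 * j₀ + r ≤ m →
                     (Inside m → PalCount a b m (suc c)) × (¬ Inside m → PalCount a b m c)
    palCount-class c P₀ ¬inside₀ m parity-m 2j₀+r≤m = subst Counted m≡ (raised , lowered)
      where
      Counted : ℕ → Set
      Counted m = (Inside m → PalCount a b m (suc c)) × (¬ Inside m → PalCount a b m c)
      j : ℕ
      j = ⌊ m /2⌋
      m≡ : 2 * j + r ≡ m
      m≡ = 2*half+parity m r≤1 parity-m
      counted : (Counter.Raised j → P j (suc c)) × (¬ Counter.Raised j → P j c)
      counted = Counter.counter c (¬inside₀ ∘ raised⇒inside) P₀ j (cancel-≤ (subst (_ ≤_) (sym m≡) 2j₀+r≤m))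
      raised : Inside (2 * j + r) → PalCount a b (2 * j + r) (suc c)
      raised = proj₁ counted ∘ inside⇒raised
      lowered : ¬ Inside (2 * j + r) → PalCount a b (2 * j + r) c
      lowered ¬inside = proj₂ counted (¬inside ∘ raised⇒inside)

  palCount-class-even : (C : ParityClass 0 0) → ∀ n →
    (ParityClass.Inside C (2 * n) → PalCount a b (2 * n) 2) × (¬ ParityClass.Inside C (2 * n) → PalCount a b (2 * n) 1)
  palCount-class-even C n = palCount-class z≤n C 1 palCount-0 (¬Inside-≤b C z≤n) (2 * n) (parity-2* n) z≤n

  palCount-class-odd : ∀ {j₀} (C : ParityClass 1 j₀) c → PalCount a b (2 * j₀ + 1) c → ¬ ParityClass.Inside C (2 * j₀ + 1) →
    ∀ n → j₀ ≤ n →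
    (ParityClass.Inside C (2 * n + 1) → PalCount a b (2 * n + 1) (suc c)) × (¬ ParityClass.Inside C (2 * n + 1) → PalCount a b (2 * n + 1) c)
  palCount-class-odd C c P₀ ¬inside₀ n j₀≤n =
    palCount-class ≤-refl C c P₀ ¬inside₀ (2 * n + 1) (parity-2*+1 n) (+-monoˡ-≤ 1 (*-monoʳ-≤ 2 j₀≤n))

  module Case-i (a-odd : parity a ≡ true) (b-even : parity b ≡ false) where
    private
      parity-∣V∣-i : ∀ n → parity (∣V∣ a b (suc n)) ≡ false xor parity n
      parity-∣V∣-i n rewrite parity-∣V∣ n | a-odd | b-even | fold-T-step-true-false n = refl
      parity-∣U∣-i : ∀ n → parity (∣U∣ a b (suc n)) ≡ false xor parity n
      parity-∣U∣-i n rewrite parity-∣U∣ n | a-odd | b-even | fold-T-step-true-false n = refl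
      module V = AlternatingParity (∣V∣ a b) false parity-∣V∣-i
      module U = AlternatingParity (∣U∣ a b) false parity-∣U∣-i

      even : ParityClass 0 0
      even = record
        { gV = λ k → 2 * suc k ∸ 1 ; gU = λ k → 2 * suc k ∸ 1
        ; 1≤gV = 1≤2*suc∸1 ; gV≤gU = λ _ → ≤-refl
        ; gU<gV = λ k → ≤-<-trans (2*suc∸1≤2*suc k) (2*suc<2*suc∸1 k)
        ; parity-V = V.odd-indices ; parity-U = U.odd-indices
        ; only-V = λ n e _ → _ , V.only-odd-indices n e ; only-U = λ n e _ → _ , U.only-odd-indices n e }

      odd : ParityClass 1 0
      odd = record
        { gV = λ k → 2 * suc k ; gU = λ k → 2 * suc k
        ; 1≤gV = λ _ → s≤s z≤n ; gV≤gU = λ _ → ≤-refl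
        ; gU<gV = λ k → <-≤-trans (2*suc<2*suc∸1 k) (2*suc∸1≤2*suc (suc k))
        ; parity-V = V.even-indices ; parity-U = U.even-indices
        ; only-V = λ n e _ → _ , V.only-even-indices n e ; only-U = λ n e _ → _ , U.only-even-indices n e }

    statement : ∀ n →
        ((∃[ k ] (1 ≤ k × ∣V∣ a b (2 * k ∸ 1) < 2 * n × 2 * n ≤ ∣U∣ a b (2 * k ∸ 1)) → PalCount a b (2 * n) 2)
        × (¬ (∃[ k ] (1 ≤ k × ∣V∣ a b (2 * k ∸ 1) < 2 * n × 2 * n ≤ ∣U∣ a b (2 * k ∸ 1))) → PalCount a b (2 * n) 1)
        × ((∃[ k ] (1 ≤ k × ∣V∣ a b (2 * k) < 2 * n + 1 × 2 * n + 1 ≤ ∣U∣ a b (2 * k))) → PalCount a b (2 * n + 1) 3)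
        × (¬ (∃[ k ] (1 ≤ k × ∣V∣ a b (2 * k) < 2 * n + 1 × 2 * n + 1 ≤ ∣U∣ a b (2 * k))) → PalCount a b (2 * n + 1) 2))
    statement n =
      let (even₂ , even₁) = via (∃-≥ 1) (palCount-class-even even n)
          (odd₃ , odd₂)   = via (∃-≥ 1) (palCount-class-odd odd 2 palCount-1 (¬Inside-≤b odd 1≤b) n z≤n)
      in even₂ , even₁ , odd₃ , odd₂

  module Case-ii (a-even : parity a ≡ false) (b-even : parity b ≡ false) where
    private
      parity-∣V∣-ii : ∀ n → parity (∣V∣ a b (suc n)) ≡ false xor parity n
      parity-∣V∣-ii n rewrite parity-∣V∣ n | a-even | b-even = total-fold-false-false (false , false) n
      parity-∣U∣-ii : ∀ n → parity (∣U∣ a b (suc n)) ≡ true xor parity n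
      parity-∣U∣-ii n rewrite parity-∣U∣ n | a-even | b-even = total-fold-false-false (true , false) n
      module V = AlternatingParity (∣V∣ a b) false parity-∣V∣-ii
      module U = AlternatingParity (∣U∣ a b) true parity-∣U∣-ii

      even : ParityClass 0 0
      even = record
        { gV = λ k → 2 * suc k ∸ 1 ; gU = λ k → 2 * suc k
        ; 1≤gV = 1≤2*suc∸1 ; gV≤gU = 2*suc∸1≤2*suc ; gU<gV = 2*suc<2*suc∸1
        ; parity-V = V.odd-indices ; parity-U = U.even-indices
        ; only-V = λ n e _ → _ , V.only-odd-indices n e ; only-U = λ n e _ → _ , U.only-even-indices n e }

      -- |U^(1)| = a - 1 = 2J + 1 is the only odd length among the V^(n), U^(n) below |V^(2)|.
      J : ℕ
      J = ⌊ ∣U∣ a b 1 /2⌋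
      2J+1≡∣U¹∣ : 2 * J + 1 ≡ ∣U∣ a b 1
      2J+1≡∣U¹∣ = 2*half+parity (∣U∣ a b 1) ≤-refl (parity-∣U∣-ii 0)

      odd : ParityClass 1 (suc J)
      odd = record
        { gV = λ k → 2 * suc k ; gU = λ k → 2 * suc k + 1
        ; 1≤gV = λ _ → s≤s z≤n ; gV≤gU = λ k → m≤m+n (2 * suc k) 1
        ; gU<gV = λ k → subst (2 * suc k + 1 <_) (trans (+-comm (2 * suc k) 2) (sym (*-suc 2 (suc k))))
                               (+-monoʳ-< (2 * suc k) ≤-refl)
        ; parity-V = V.even-indices
        ; parity-U = λ k → subst (λ i → parity (∣U∣ a b i) ≡ true) (sym (2*suc+1≡2*suc∸1 k)) (U.odd-indices (suc k))
        ; only-V = λ n e _ → _ , V.only-even-indices n e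
        ; only-U = only-U }
        where
        only-U : ∀ n → parity (∣U∣ a b (suc n)) ≡ true → 2 * suc J + 1 ≤ ∣U∣ a b (suc n) → ∃ λ k → suc n ≡ 2 * suc k + 1
        only-U n e big with ⌊ n /2⌋ | U.only-odd-indices n e
        ... | zero  | refl  = contradiction big (<⇒≱ (subst (_< 2 * suc J + 1) 2J+1≡∣U¹∣ (+-monoˡ-< 1 (*-monoʳ-< 2 ≤-refl))))
        ... | suc k | 1+n≡ = k , trans 1+n≡ (sym (2*suc+1≡2*suc∸1 k))

      no-events-below-∣U¹∣ : ∀ j → j < J → ¬ IsVLength (2 * j + 1) × ¬ IsULength (2 * j + 1)
      no-events-below-∣U¹∣ j j<J = ¬V , ¬U
        where
        2j+1<∣U¹∣ : 2 * j + 1 < ∣U∣ a b 1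
        2j+1<∣U¹∣ = subst (2 * j + 1 <_) 2J+1≡∣U¹∣ (+-monoˡ-< 1 (*-monoʳ-< 2 j<J))
        ¬V : ¬ IsVLength (2 * j + 1)
        ¬V (zero  , e) = contradiction (trans (sym (parity-∣V∣-ii 0)) (trans (cong parity e) (parity-2*+1 j))) (λ ())
        ¬V (suc n , e) = <-asym 2j+1<∣U¹∣ (subst (∣U∣ a b 1 <_) e (∣U∣<∣V∣ {1} {suc (suc n)} (s≤s (s≤s z≤n))))
        ¬U : ¬ IsULength (2 * j + 1)
        ¬U (n , e) = <⇒≱ 2j+1<∣U¹∣ (subst (∣U∣ a b 1 ≤_) e (U-lengths.mono-≤ {1} {suc n} (s≤s z≤n)))

      below-∣U¹∣ : ∀ j → j ≤ J → PalCount a b (2 * j + 1) 2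
      below-∣U¹∣ j = palCount-flat-run 1 2 (λ j _ → no-events-below-∣U¹∣ j) palCount-1 j z≤n

      above-∣U¹∣ : PalCount a b (2 * suc J + 1) 1
      above-∣U¹∣ = palCount-U-step J 1 (below-∣U¹∣ J ≤-refl) (0 , sym 2J+1≡∣U¹∣)

      ¬inside-above-∣U¹∣ : ¬ ParityClass.Inside odd (2 * suc J + 1)
      ¬inside-above-∣U¹∣ (k , V< , _) = <⇒≱ V< (begin
        2 * suc J + 1        ≡⟨ sym (2+[2*j+r] J 1) ⟩
        2 + (2 * J + 1)      ≡⟨ cong (2 +_) 2J+1≡∣U¹∣ ⟩
        2 + ∣U∣ a b 1        ≤⟨ same-parity-gap (trans (parity-∣U∣-ii 0) (sym (V.even-indices 0))) (∣U∣<∣V∣-next 1) ⟩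
        ∣V∣ a b 2            ≤⟨ V-lengths.mono-≤ {2} {2 * suc k} (*-monoʳ-≤ 2 (s≤s z≤n)) ⟩
        ∣V∣ a b (2 * suc k)  ∎)
        where open ≤-Reasoning

    statement : ∀ n →
        ((∃[ k ] (1 ≤ k × ∣V∣ a b (2 * k ∸ 1) < 2 * n × 2 * n ≤ ∣U∣ a b (2 * k))) → PalCount a b (2 * n) 2)
        × (¬ (∃[ k ] (1 ≤ k × ∣V∣ a b (2 * k ∸ 1) < 2 * n × 2 * n ≤ ∣U∣ a b (2 * k))) → PalCount a b (2 * n) 1)
        × ((2 * n + 1 ≤ a ∸ 1 ⊎ ∃[ k ] (1 ≤ k × ∣V∣ a b (2 * k) < 2 * n + 1 × 2 * n + 1 ≤ ∣U∣ a b (2 * k + 1))) → PalCount a b (2 * n + 1) 2)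
        × (¬ (2 * n + 1 ≤ a ∸ 1 ⊎ ∃[ k ] (1 ≤ k × ∣V∣ a b (2 * k) < 2 * n + 1 × 2 * n + 1 ≤ ∣U∣ a b (2 * k + 1))) → PalCount a b (2 * n + 1) 1)
    statement n =
      let (even₂ , even₁) = via (∃-≥ 1) (palCount-class-even even n)
          (odd₂ , odd₁)   = odd-lengths (n ≤? J)
      in even₂ , even₁ , odd₂ , odd₁
      where
      2n+1≤a∸1⇔n≤J : 2 * n + 1 ≤ a ∸ 1 ⇔ n ≤ J
      2n+1≤a∸1⇔n≤J = mk⇔ (λ le → *-cancelˡ-≤ 2 (+-cancelʳ-≤ 1 _ _ (subst (2 * n + 1 ≤_) (sym ∣U¹∣≡) le)))
                         (λ n≤J → subst (2 * n + 1 ≤_) ∣U¹∣≡ (+-monoˡ-≤ 1 (*-monoʳ-≤ 2 n≤J)))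
        where
        ∣U¹∣≡ : 2 * J + 1 ≡ a ∸ 1
        ∣U¹∣≡ = trans 2J+1≡∣U¹∣ (length-replicate (a ∸ 1))
      Short⊎Inside : Set
      Short⊎Inside = 2 * n + 1 ≤ a ∸ 1 ⊎ ∃[ k ] (1 ≤ k × ∣V∣ a b (2 * k) < 2 * n + 1 × 2 * n + 1 ≤ ∣U∣ a b (2 * k + 1))
      odd-lengths : Dec (n ≤ J) → (Short⊎Inside → PalCount a b (2 * n + 1) 2) × (¬ Short⊎Inside → PalCount a b (2 * n + 1) 1)
      odd-lengths (yes n≤J) = (λ _ → below-∣U¹∣ n n≤J) , (λ ¬short → contradiction (inj₁ (from 2n+1≤a∸1⇔n≤J n≤J)) ¬short)
      odd-lengths (no n≰J)  =
        via (⊎-⇔ (n≰J ∘ to 2n+1≤a∸1⇔n≤J) (∃-≥ 1))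
            (palCount-class-odd odd 1 above-∣U¹∣ ¬inside-above-∣U¹∣ n (≰⇒> n≰J))

  module Case-iii (a-even : parity a ≡ false) (b-odd : parity b ≡ true) where
    private
      parity-∣V∣-iii : ∀ k → 1 ≤ k → ParityByResidue (parity (∣V∣ a b k)) (k % 3)
      parity-∣V∣-iii (suc n) _ rewrite parity-∣V∣ n | a-even | b-odd = total-fold-false-true n
      parity-∣U∣-iii : ∀ k → 1 ≤ k → ParityByResidue (parity (∣U∣ a b k)) (k % 3)
      parity-∣U∣-iii (suc n) _ rewrite parity-∣U∣ n | a-even | b-odd = total-fold-false-true n

      residue-2⇒even : ∀ {p r} → ParityByResidue p r → r ≡ 2 → p ≡ false
      residue-2⇒even (inj₁ (p≡ , _))  _  = p≡
      residue-2⇒even (inj₂ (_ , r≢2)) r≡ = contradiction r≡ r≢2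

      residue-≢2⇒odd : ∀ {p r} → ParityByResidue p r → r ≢ 2 → p ≡ true
      residue-≢2⇒odd (inj₁ (_ , r≡2)) r≢ = contradiction r≡2 r≢
      residue-≢2⇒odd (inj₂ (p≡ , _))  _  = p≡

      even⇒residue-2 : ∀ {p r} → ParityByResidue p r → p ≡ false → r ≡ 2
      even⇒residue-2 (inj₁ (_ , r≡2)) _  = r≡2
      even⇒residue-2 (inj₂ (p≡ , _))  p≡′ = contradiction (trans (sym p≡) p≡′) (λ ())

      odd⇒residue-≢2 : ∀ {p r} → ParityByResidue p r → p ≡ true → r ≢ 2
      odd⇒residue-≢2 (inj₁ (p≡ , _))  p≡′ = contradiction (trans (sym p≡) p≡′) (λ ())
      odd⇒residue-≢2 (inj₂ (_ , r≢2)) _   = r≢2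

      1≤3*suc∸1 : ∀ i → 1 ≤ 3 * suc i ∸ 1
      1≤3*suc∸1 i = subst (1 ≤_) (sym (3*suc∸1≡2+3* i)) (s≤s z≤n)

      even : ParityClass 0 0
      even = record
        { gV = λ i → 3 * suc i ∸ 1 ; gU = λ i → 3 * suc i ∸ 1
        ; 1≤gV = 1≤3*suc∸1 ; gV≤gU = λ _ → ≤-refl
        ; gU<gV = λ i → subst₂ _<_ (sym (3*suc∸1≡2+3* i)) (sym (3*suc∸1≡2+3* (suc i))) (+-monoʳ-< 2 (*-monoʳ-< 3 ≤-refl))
        ; parity-V = λ i → residue-2⇒even (parity-∣V∣-iii _ (1≤3*suc∸1 i)) ([3*suc∸1]%3 i)
        ; parity-U = λ i → residue-2⇒even (parity-∣U∣-iii _ (1≤3*suc∸1 i)) ([3*suc∸1]%3 i)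
        ; only-V = λ n e _ → %3≡2⇒ (suc n) (even⇒residue-2 (parity-∣V∣-iii (suc n) (s≤s z≤n)) e)
        ; only-U = λ n e _ → %3≡2⇒ (suc n) (even⇒residue-2 (parity-∣U∣-iii (suc n) (s≤s z≤n)) e) }

      odd : ParityClass 1 0
      odd = record
        { gV = not-2-mod-3 ; gU = not-2-mod-3
        ; 1≤gV = proj₁ ∘ not-2-mod-3-spec ; gV≤gU = λ _ → ≤-refl ; gU<gV = not-2-mod-3-<
        ; parity-V = λ i → let (1≤ , ≢2) = not-2-mod-3-spec i in residue-≢2⇒odd (parity-∣V∣-iii _ 1≤) ≢2
        ; parity-U = λ i → let (1≤ , ≢2) = not-2-mod-3-spec i in residue-≢2⇒odd (parity-∣U∣-iii _ 1≤) ≢2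
        ; only-V = λ n e _ → not-2-mod-3-onto (suc n) (s≤s z≤n) (odd⇒residue-≢2 (parity-∣V∣-iii (suc n) (s≤s z≤n)) e)
        ; only-U = λ n e _ → not-2-mod-3-onto (suc n) (s≤s z≤n) (odd⇒residue-≢2 (parity-∣U∣-iii (suc n) (s≤s z≤n)) e) }

      ∃-not-2-mod-3 : ∀ {P : ℕ → Set} → (∃[ k ] (1 ≤ k × k % 3 ≢ 2 × P k)) ⇔ (∃[ i ] P (not-2-mod-3 i))
      ∃-not-2-mod-3 {P} = mk⇔ (λ (k , 1≤k , k≢2 , Pk) → let (i , k≡) = not-2-mod-3-onto k 1≤k k≢2 in i , subst P k≡ Pk)
                              (λ (i , Pi) → let (1≤ , ≢2) = not-2-mod-3-spec i in not-2-mod-3 i , 1≤ , ≢2 , Pi)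

    statement : ∀ n →
        ((∃[ k ] (1 ≤ k × ∣V∣ a b (3 * k ∸ 1) < 2 * n × 2 * n ≤ ∣U∣ a b (3 * k ∸ 1))) → PalCount a b (2 * n) 2)
        × (¬ (∃[ k ] (1 ≤ k × ∣V∣ a b (3 * k ∸ 1) < 2 * n × 2 * n ≤ ∣U∣ a b (3 * k ∸ 1))) → PalCount a b (2 * n) 1)
        × ((∃[ k ] (1 ≤ k × k % 3 ≢ 2 × ∣V∣ a b k < 2 * n + 1 × 2 * n + 1 ≤ ∣U∣ a b k)) → PalCount a b (2 * n + 1) 3)
        × (¬ (∃[ k ] (1 ≤ k × k % 3 ≢ 2 × ∣V∣ a b k < 2 * n + 1 × 2 * n + 1 ≤ ∣U∣ a b k)) → PalCount a b (2 * n + 1) 2)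
    statement n =
      let (even₂ , even₁) = via (∃-≥ 1) (palCount-class-even even n)
          (odd₃ , odd₂)   = via ∃-not-2-mod-3 (palCount-class-odd odd 2 palCount-1 (¬Inside-≤b odd 1≤b) n z≤n)
      in even₂ , even₁ , odd₃ , odd₂

  module Case-iv (a-odd : parity a ≡ true) (b-odd : parity b ≡ true) where
    private
      parity-∣V∣-iv : ∀ n → parity (∣V∣ a b (suc n)) ≡ true
      parity-∣V∣-iv zero    rewrite parity-∣V∣ 0 | b-odd = refl
      parity-∣V∣-iv (suc n) rewrite parity-∣V∣ (suc n) | a-odd | b-odd = total-T-step-true-true (fold (true , false) (T-step true true) n)
      parity-∣U∣-iv : ∀ n → parity (∣U∣ a b (2 + n)) ≡ true
      parity-∣U∣-iv n rewrite parity-∣U∣ (suc n) | a-odd | b-odd = total-T-step-true-true (fold (false , false) (T-step true true) n)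
      parity-∣U¹∣ : parity (∣U∣ a b 1) ≡ false
      parity-∣U¹∣ rewrite parity-∣U∣ 0 | a-odd = refl

      -- Even lengths: the only event is |U^(1)| = a - 1 = 2J.
      J : ℕ
      J = ⌊ ∣U∣ a b 1 /2⌋
      2J≡∣U¹∣ : 2 * J + 0 ≡ ∣U∣ a b 1
      2J≡∣U¹∣ = 2*half+parity (∣U∣ a b 1) z≤n parity-∣U¹∣

      no-even-events : ∀ j → j ≢ J → ¬ IsVLength (2 * j + 0) × ¬ IsULength (2 * j + 0)
      no-even-events j j≢J = ¬V , ¬U
        where
        ¬V : ¬ IsVLength (2 * j + 0)
        ¬V (n , e) = contradiction (trans (sym (parity-∣V∣-iv n)) (trans (cong parity e) (parity-2*+ j 0))) (λ ())
        ¬U : ¬ IsULength (2 * j + 0)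
        ¬U (zero  , e) = j≢J (*-cancelˡ-≡ j J 2 (+-cancelʳ-≡ 0 _ _ (trans (sym e) (sym 2J≡∣U¹∣))))
        ¬U (suc n , e) = contradiction (trans (sym (parity-∣U∣-iv n)) (trans (cong parity e) (parity-2*+ j 0))) (λ ())

      up-to-∣U¹∣ : ∀ j → j ≤ J → PalCount a b (2 * j + 0) 1
      up-to-∣U¹∣ j = palCount-flat-run 0 1 (λ i _ i<J → no-even-events i (<⇒≢ i<J)) palCount-0 j z≤n

      beyond-∣U¹∣ : ∀ j → J < j → PalCount a b (2 * j + 0) 0
      beyond-∣U¹∣ j J<j = palCount-flat-run 0 0 (λ i J<i _ → no-even-events i (>⇒≢ J<i))
                            (palCount-U-step J 0 (up-to-∣U¹∣ J ≤-refl) (0 , sym 2J≡∣U¹∣)) j J<j ≤-refl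

      -- Odd lengths: first the event |V^(1)| = b = 2K + 1, then V^(n), U^(n) for n ≥ 2.
      K : ℕ
      K = ⌊ ∣V∣ a b 1 /2⌋
      2K+1≡∣V¹∣ : 2 * K + 1 ≡ ∣V∣ a b 1
      2K+1≡∣V¹∣ = 2*half+parity (∣V∣ a b 1) ≤-refl (parity-∣V∣-iv 0)

      no-odd-events-below-b : ∀ j → j < K → ¬ IsVLength (2 * j + 1) × ¬ IsULength (2 * j + 1)
      no-odd-events-below-b j j<K = ¬V , ¬U
        where
        2j+1<∣V¹∣ : 2 * j + 1 < ∣V∣ a b 1
        2j+1<∣V¹∣ = subst (2 * j + 1 <_) 2K+1≡∣V¹∣ (+-monoˡ-< 1 (*-monoʳ-< 2 j<K))
        ¬V : ¬ IsVLength (2 * j + 1)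
        ¬V (n , e) = <⇒≱ 2j+1<∣V¹∣ (subst (∣V∣ a b 1 ≤_) e (V-lengths.mono-≤ {1} {suc n} (s≤s z≤n)))
        ¬U : ¬ IsULength (2 * j + 1)
        ¬U (n , e) = <-asym 2j+1<∣V¹∣ (subst (∣V∣ a b 1 <_) e (∣V∣<∣U∣ {1} {suc n} (s≤s z≤n) (s≤s z≤n)))

      up-to-b : ∀ j → j ≤ K → PalCount a b (2 * j + 1) 2
      up-to-b j = palCount-flat-run 1 2 (λ i _ → no-odd-events-below-b i) palCount-1 j z≤n

      odd : ParityClass 1 (suc K)
      odd = record
        { gV = 2 +_ ; gU = 2 +_
        ; 1≤gV = λ _ → s≤s z≤n ; gV≤gU = λ _ → ≤-refl ; gU<gV = λ k → n<1+n (2 + k)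
        ; parity-V = λ k → parity-∣V∣-iv (suc k) ; parity-U = parity-∣U∣-iv
        ; only-V = only-V ; only-U = only-U }
        where
        only-V : ∀ n → parity (∣V∣ a b (suc n)) ≡ true → 2 * suc K + 1 ≤ ∣V∣ a b (suc n) → ∃ λ k → suc n ≡ 2 + k
        only-V zero    _ big = contradiction big (<⇒≱ (subst (_< 2 * suc K + 1) 2K+1≡∣V¹∣ (+-monoˡ-< 1 (*-monoʳ-< 2 ≤-refl))))
        only-V (suc n) _ _   = n , refl
        only-U : ∀ n → parity (∣U∣ a b (suc n)) ≡ true → 2 * suc K + 1 ≤ ∣U∣ a b (suc n) → ∃ λ k → suc n ≡ 2 + k
        only-U zero    e _ = contradiction (trans (sym parity-∣U¹∣) e) (λ ())
        only-U (suc n) _ _ = n , refl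

      beyond-b : PalCount a b (2 * suc K + 1) 3
      beyond-b = palCount-V-step K 1 (up-to-b K ≤-refl) (0 , sym 2K+1≡∣V¹∣)

      2K+3≤∣V∣ : ∀ k → 2 * suc K + 1 ≤ ∣V∣ a b (2 + k)
      2K+3≤∣V∣ k = begin
        2 * suc K + 1        ≡⟨ sym (2+[2*j+r] K 1) ⟩
        2 + (2 * K + 1)      ≡⟨ cong (2 +_) 2K+1≡∣V¹∣ ⟩
        2 + ∣V∣ a b 1        ≤⟨ same-parity-gap (trans (parity-∣V∣-iv 0) (sym (parity-∣V∣-iv 1))) (∣V∣-increasing 1) ⟩
        ∣V∣ a b 2            ≤⟨ V-lengths.mono-≤ {2} {2 + k} (m≤m+n 2 k) ⟩
        ∣V∣ a b (2 + k)      ∎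
        where open ≤-Reasoning

    statement : ∀ n →
        ((2 * n ≤ a ∸ 1) → PalCount a b (2 * n) 1)
        × (¬ (2 * n ≤ a ∸ 1) → PalCount a b (2 * n) 0)
        × ((2 * n + 1 ≤ b) → PalCount a b (2 * n + 1) 2)
        × ((∃[ k ] (2 ≤ k × ∣V∣ a b k < 2 * n + 1 × 2 * n + 1 ≤ ∣U∣ a b k)) → PalCount a b (2 * n + 1) 4)
        × (¬ (2 * n + 1 ≤ b) → ¬ (∃[ k ] (2 ≤ k × ∣V∣ a b k < 2 * n + 1 × 2 * n + 1 ≤ ∣U∣ a b k)) → PalCount a b (2 * n + 1) 3)
    statement n = short-even , long-even , short-odd , inside , outside
      where
      Long : Set
      Long = ∃[ k ] (2 ≤ k × ∣V∣ a b k < 2 * n + 1 × 2 * n + 1 ≤ ∣U∣ a b k)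

      2n≤a∸1⇔n≤J : 2 * n ≤ a ∸ 1 ⇔ n ≤ J
      2n≤a∸1⇔n≤J = mk⇔ (λ le → *-cancelˡ-≤ 2 (subst (2 * n ≤_) (sym 2J≡a∸1) le))
                       (λ n≤J → subst (2 * n ≤_) 2J≡a∸1 (*-monoʳ-≤ 2 n≤J))
        where
        2J≡a∸1 : 2 * J ≡ a ∸ 1
        2J≡a∸1 = trans (sym (+-identityʳ _)) (trans 2J≡∣U¹∣ (length-replicate (a ∸ 1)))

      2n+1≤b⇔n≤K : 2 * n + 1 ≤ b ⇔ n ≤ K
      2n+1≤b⇔n≤K = mk⇔ (λ le → *-cancelˡ-≤ 2 (+-cancelʳ-≤ 1 _ _ (subst (2 * n + 1 ≤_) (sym 2K+1≡b) le)))
                       (λ n≤K → subst (2 * n + 1 ≤_) 2K+1≡b (+-monoˡ-≤ 1 (*-monoʳ-≤ 2 n≤K)))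
        where
        2K+1≡b : 2 * K + 1 ≡ b
        2K+1≡b = trans 2K+1≡∣V¹∣ (length-replicate b)

      even : ∀ {c} → PalCount a b (2 * n + 0) c → PalCount a b (2 * n) c
      even {c} = subst (λ m → PalCount a b m c) (+-identityʳ (2 * n))

      beyond-b-class : K < n → (ParityClass.Inside odd (2 * n + 1) → PalCount a b (2 * n + 1) 4)
                             × (¬ ParityClass.Inside odd (2 * n + 1) → PalCount a b (2 * n + 1) 3)
      beyond-b-class = palCount-class-odd odd 3 beyond-b (λ (k , V< , _) → <⇒≱ V< (2K+3≤∣V∣ k)) n

      short-even : 2 * n ≤ a ∸ 1 → PalCount a b (2 * n) 1
      short-even = even ∘ up-to-∣U¹∣ n ∘ to 2n≤a∸1⇔n≤J

      long-even : ¬ (2 * n ≤ a ∸ 1) → PalCount a b (2 * n) 0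
      long-even 2n≰ = even (beyond-∣U¹∣ n (≰⇒> (2n≰ ∘ from 2n≤a∸1⇔n≤J)))

      short-odd : 2 * n + 1 ≤ b → PalCount a b (2 * n + 1) 2
      short-odd = up-to-b n ∘ to 2n+1≤b⇔n≤K

      inside : Long → PalCount a b (2 * n + 1) 4
      inside long = let (k , V< , ≤U) = to (∃-≥ 2) long
                        K<n = *-cancelˡ-≤ 2 (+-cancelʳ-≤ 1 _ _ (<⇒≤ (≤-<-trans (2K+3≤∣V∣ k) V<)))
                    in proj₁ (beyond-b-class K<n) (k , V< , ≤U)

      outside : ¬ (2 * n + 1 ≤ b) → ¬ Long → PalCount a b (2 * n + 1) 3
      outside 2n+1≰b ¬long = proj₂ (beyond-b-class (≰⇒> (2n+1≰b ∘ from 2n+1≤b⇔n≤K))) (¬long ∘ from (∃-≥ 2))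

theorem5p17 : (a b : ℕ) → 1 ≤ b → b < a ∸ 1 → (n : ℕ) →
  -- (i) b even, a odd
  ((2 ∣ b) → ¬ (2 ∣ a) →
    ((∃[ k ] (1 ≤ k × ∣V∣ a b (2 * k ∸ 1) < 2 * n × 2 * n ≤ ∣U∣ a b (2 * k ∸ 1)) → PalCount a b (2 * n) 2)
    × (¬ (∃[ k ] (1 ≤ k × ∣V∣ a b (2 * k ∸ 1) < 2 * n × 2 * n ≤ ∣U∣ a b (2 * k ∸ 1))) → PalCount a b (2 * n) 1)
    × ((∃[ k ] (1 ≤ k × ∣V∣ a b (2 * k) < 2 * n + 1 × 2 * n + 1 ≤ ∣U∣ a b (2 * k))) → PalCount a b (2 * n + 1) 3)
    × (¬ (∃[ k ] (1 ≤ k × ∣V∣ a b (2 * k) < 2 * n + 1 × 2 * n + 1 ≤ ∣U∣ a b (2 * k))) → PalCount a b (2 * n + 1) 2)))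
  ×
  -- (ii) a, b both even
  ((2 ∣ a) → (2 ∣ b) →
    ((∃[ k ] (1 ≤ k × ∣V∣ a b (2 * k ∸ 1) < 2 * n × 2 * n ≤ ∣U∣ a b (2 * k))) → PalCount a b (2 * n) 2)
    × (¬ (∃[ k ] (1 ≤ k × ∣V∣ a b (2 * k ∸ 1) < 2 * n × 2 * n ≤ ∣U∣ a b (2 * k))) → PalCount a b (2 * n) 1)
    × ((2 * n + 1 ≤ a ∸ 1 ⊎ ∃[ k ] (1 ≤ k × ∣V∣ a b (2 * k) < 2 * n + 1 × 2 * n + 1 ≤ ∣U∣ a b (2 * k + 1))) → PalCount a b (2 * n + 1) 2)
    × (¬ (2 * n + 1 ≤ a ∸ 1 ⊎ ∃[ k ] (1 ≤ k × ∣V∣ a b (2 * k) < 2 * n + 1 × 2 * n + 1 ≤ ∣U∣ a b (2 * k + 1))) → PalCount a b (2 * n + 1) 1))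
  ×
  -- (iii) b odd, a even
  (¬ (2 ∣ b) → (2 ∣ a) →
    ((∃[ k ] (1 ≤ k × ∣V∣ a b (3 * k ∸ 1) < 2 * n × 2 * n ≤ ∣U∣ a b (3 * k ∸ 1))) → PalCount a b (2 * n) 2)
    × (¬ (∃[ k ] (1 ≤ k × ∣V∣ a b (3 * k ∸ 1) < 2 * n × 2 * n ≤ ∣U∣ a b (3 * k ∸ 1))) → PalCount a b (2 * n) 1)
    × ((∃[ k ] (1 ≤ k × k % 3 ≢ 2 × ∣V∣ a b k < 2 * n + 1 × 2 * n + 1 ≤ ∣U∣ a b k)) → PalCount a b (2 * n + 1) 3)
    × (¬ (∃[ k ] (1 ≤ k × k % 3 ≢ 2 × ∣V∣ a b k < 2 * n + 1 × 2 * n + 1 ≤ ∣U∣ a b k)) → PalCount a b (2 * n + 1) 2))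
  ×
  -- (iv) a, b both odd
  (¬ (2 ∣ a) → ¬ (2 ∣ b) →
    ((2 * n ≤ a ∸ 1) → PalCount a b (2 * n) 1)
    × (¬ (2 * n ≤ a ∸ 1) → PalCount a b (2 * n) 0)
    × ((2 * n + 1 ≤ b) → PalCount a b (2 * n + 1) 2)
    × ((∃[ k ] (2 ≤ k × ∣V∣ a b k < 2 * n + 1 × 2 * n + 1 ≤ ∣U∣ a b k)) → PalCount a b (2 * n + 1) 4)
    × (¬ (2 * n + 1 ≤ b) → ¬ (∃[ k ] (2 ≤ k × ∣V∣ a b k < 2 * n + 1 × 2 * n + 1 ≤ ∣U∣ a b k)) → PalCount a b (2 * n + 1) 3))
theorem5p17 a b 1≤b b<a∸1 n =
  (λ 2∣b 2∤a → Case-i.statement (2∤⇒odd 2∤a) (2∣⇒even 2∣b) n) ,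
  (λ 2∣a 2∣b → Case-ii.statement (2∣⇒even 2∣a) (2∣⇒even 2∣b) n) ,
  (λ 2∤b 2∣a → Case-iii.statement (2∣⇒even 2∣a) (2∤⇒odd 2∤b) n) ,
  (λ 2∤a 2∤b → Case-iv.statement (2∤⇒odd 2∤a) (2∤⇒odd 2∤b) n)
  where open Uβ a b 1≤b b<a∸1
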